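{- Let $n\geq 7$ be an integer, let $q,r,s\in\mathbb{R}$ with $q\neq 0$, and let $t$ be an indeterminate. Put $n_0=(n-1)/2$ if $n$ is odd and $n_0=n/2$ if $n$ is even, and $n_1=n_0-1$ if $n$ is odd, $n_1=n_0-2$ if $n$ is even. Define the $n\times n$ matrices $W(t)_k=(w_{ij}(t)_k)$ over $\mathbb{R}(t)$ for $1\le k\le n_1$ as follows: $w_{ij}(t)_1=qt$ if $i+j=n$ and $2\le i,j\le n-2$; $w_{ij}(t)_1=rt$ if $i+j=n+1$ and $2\le i,j\le n-1$; $w_{ij}(t)_1=st$ if $i+j=n+2$ and $2\le i,j\le n$; and $w_{ij}(t)_1=0$ otherwise. For $2\le k\le n_1$, put $W(t)_k={}^tS(t)_kW(t)_{k-1}S(t)_k$, where \[ S(t)_k=\prod_{m=n-k+1}^{n}R_n\!\left(n-k,m;-\frac{w_{km}(t)_{k-1}}{qt}\right) \] (product taken in increasing order of $m$, each factor evaluated using the entries of $W(t)_{k-1}$). Define sequences by \[ x_0=0,\ x_1=-qt,\ x_2=rt,\ x_{m+2}=-\tfrac{r}{q}x_{m+1}-\tfrac{s}{q}x_m\ (m\ge 1),\qquad y_0=y_1=0,\ y_{m+1}=-\tfrac{s}{q}x_m\ (m\ge 1). \] Then for every integer $k$ with $2\le k\le n_1$, \[ w_{ij}(t)_k=\begin{cases} 0 & (i,j)=(k,\ell)\text{ or }(\ell,k),\ n-k+1\le \ell\le n,\\ x_{\ell-n+k+2} & (i,j)=(k+1,\ell)\text{ or }(\ell,k+1),\ n-k\le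 \ell\le n-1,\\ y_{\ell-n+k+2} & (i,j)=(k+2,\ell)\text{ or }(\ell,k+2),\ n-k\le \ell\le n-1,\\ -s x_k/q & (i,j)=(k+1,n)\text{ or }(n,k+1),\\ -s y_k/q & (i,j)=(k+2,n)\text{ or }(n,k+2),\\ w_{ij}(t)_{k-1} & \text{otherwise}. \end{cases} \]
   Context: For $1\le k,l\le n$ with $k\ne l$ and a scalar $c$, $R_n(k,l;c)$ denotes the $n\times n$ elementary matrix equal to the identity matrix except that its $(k,l)$ entry is $c$. ${}^tS$ denotes the transpose of $S$. -}

module Defs where

open import Level using (Level; _⊔_)
open import Algebra.Bundles using (CommutativeRing)
open import Data.Nat as ℕ using (ℕ; zero; suc; _∸_; _≡ᵇ_; _≤ᵇ_; ⌊_/2⌋; _%_)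
open import Data.Bool using (Bool; true; false; if_then_else_; _∧_; _∨_)
open import Data.Fin using (Fin; toℕ)
open import Data.List using (List; foldr)
open import Relation.Nullary using (¬_)

-- A field: a commutative ring with 0 ≠ 1 in which every nonzero element has an
-- inverse (the inverse operation is total; its value at 0 is unconstrained).
record Field (c ℓ : Level) : Set (Level.suc (c ⊔ ℓ)) where
  field
    commutativeRing : CommutativeRing c ℓ
  open CommutativeRing commutativeRing public
  field
    _⁻¹       : Carrier → Carrier
    0≉1       : ¬ (0# ≈ 1#)
    ⁻¹-inverse : ∀ x → ¬ (x ≈ 0#) → x * (x ⁻¹) ≈ 1#

n₀ : ℕ → ℕ
n₀ n = ⌊ n /2⌋

n₁ : ℕ → ℕ
n₁ n = if (n % 2 ≡ᵇ 1) then n₀ n ∸ 1 else n₀ n ∸ 2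

inRange : ℕ → ℕ → ℕ → Bool
inRange a l b = (a ≤ᵇ l) ∧ (l ≤ᵇ b)

module Construction {c ℓ} (F : Field c ℓ) where
  open Field F

  -- n × n matrices over F, indexed by Fin n (index i stands for the
  -- 1-based index toℕ i + 1 of the paper).
  Matrix : ℕ → Set c
  Matrix n = Fin n → Fin n → Carrier

  idx : ∀ {n} → Fin n → ℕ
  idx i = ℕ.suc (toℕ i)

  Σ[_] : ∀ n → (Fin n → Carrier) → Carrier
  Σ[ zero ] f = 0#
  Σ[ suc n ] f = f Fin.zero + Σ[ n ] (λ i → f (Fin.suc i))
    where import Data.Fin as Fin

  _⊗_ : ∀ {n} → Matrix n → Matrix n → Matrix n
  _⊗_ {n} A B i j = Σ[ n ] (λ l → A i l * B l j)

  transpose : ∀ {n} → Matrix n → Matrix n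
  transpose A i j = A j i

  identity : ∀ {n} → Matrix n
  identity i j = if idx i ≡ᵇ idx j then 1# else 0#

  R : ∀ n → ℕ → ℕ → Carrier → Matrix n
  R n k l x i j =
    if (idx i ≡ᵇ k) ∧ (idx j ≡ᵇ l) then x
    else (if idx i ≡ᵇ idx j then 1# else 0#)

  module Params (n : ℕ) (q r s t : Carrier) where

    W₁ : Matrix n
    W₁ i j =
      let I = idx i ; J = idx j in
      if (I ℕ.+ J ≡ᵇ n) ∧ inRange 2 I (n ∸ 2) ∧ inRange 2 J (n ∸ 2) then q * t
      else if (I ℕ.+ J ≡ᵇ suc n) ∧ inRange 2 I (n ∸ 1) ∧ inRange 2 J (n ∸ 1) then r * t
      else if (I ℕ.+ J ≡ᵇ suc (suc n)) ∧ inRange 2 I n ∧ inRange 2 J n then s * t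
      else 0#

    -- entry w_{ab} of a matrix at 1-based indices (0 if out of range)
    entry : Matrix n → ℕ → ℕ → Carrier
    entry A a b = go a b
      where
        open import Data.Fin using (fromℕ<)
        open import Data.Nat using (_<?_)
        open import Relation.Nullary using (yes; no)
        go : ℕ → ℕ → Carrier
        go (suc a) (suc b) with a <? n | b <? n
        ... | yes p | yes p' = A (fromℕ< p) (fromℕ< p')
        ... | _ | _ = 0#
        go _ _ = 0#

    range : ℕ → ℕ → List ℕ
    range a zero = List.[]
      where import Data.List as List
    range a (suc len) = a List.∷ range (suc a) len
      where import Data.List as List

    S : ℕ → Matrix n → Matrix n
    S k Wprev =
      foldr (λ m acc → R n (n ∸ k) m (- (entry Wprev k m * ((q * t) ⁻¹))) ⊗ acc)
            identity (range (suc (n ∸ k)) k)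

    -- W(t)_k for k ≥ 1 (W 0 is an unused junk value).
    W : ℕ → Matrix n
    W zero = W₁
    W (suc zero) = W₁
    W (suc (suc j)) =
      let k = suc (suc j) ; Sk = S k (W (suc j)) in
      (transpose Sk ⊗ W (suc j)) ⊗ Sk

    x : ℕ → Carrier
    x zero = 0#
    x (suc zero) = - (q * t)
    x (suc (suc zero)) = r * t
    x (suc (suc (suc m))) =
      (- (r * q ⁻¹)) * x (suc (suc m)) + (- (s * q ⁻¹)) * x (suc m)

    y : ℕ → Carrier
    y zero = 0#
    y (suc zero) = 0#
    y (suc (suc m)) = (- (s * q ⁻¹)) * x (suc m)

    -- right-hand side of the claimed formula for w_{IJ}(t)_k
    -- (1-based I, J); prev = w_{IJ}(t)_{k-1}.
    expected : ℕ → ℕ → ℕ → Carrier → Carrier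
    expected k I J prev =
      if (I ≡ᵇ k) ∧ inRange (suc (n ∸ k)) J n then 0#
      else if (J ≡ᵇ k) ∧ inRange (suc (n ∸ k)) I n then 0#
      else if (I ≡ᵇ suc k) ∧ inRange (n ∸ k) J (n ∸ 1) then x ((J ℕ.+ k ℕ.+ 2) ∸ n)
      else if (J ≡ᵇ suc k) ∧ inRange (n ∸ k) I (n ∸ 1) then x ((I ℕ.+ k ℕ.+ 2) ∸ n)
      else if (I ≡ᵇ suc (suc k)) ∧ inRange (n ∸ k) J (n ∸ 1) then y ((J ℕ.+ k ℕ.+ 2) ∸ n)
      else if (J ≡ᵇ suc (suc k)) ∧ inRange (n ∸ k) I (n ∸ 1) then y ((I ℕ.+ k ℕ.+ 2) ∸ n)
      else if ((I ≡ᵇ suc k) ∧ (J ≡ᵇ n)) ∨ ((I ≡ᵇ n) ∧ (J ≡ᵇ suc k)) then - (s * x k * q ⁻¹)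
      else if ((I ≡ᵇ suc (suc k)) ∧ (J ≡ᵇ n)) ∨ ((I ≡ᵇ n) ∧ (J ≡ᵇ suc (suc k))) then - (s * y k * q ⁻¹)
      else prev

{-# OPTIONS --safe #-}
module Submission where

-- Write a = n - k.  S(t)_k is the identity except in row a, where it adds the
-- multipliers v_m = -w_{km}/(qt) for m > a; hence ᵗS W S = W + v ⊗ (row a of W)
-- + (column a of W) ⊗ v, the term with w_{aa} = 0 dropping out.  In W(t)_{k-1} the
-- pivot row a is still the row of W(t)_1: qt, rt, st in columns k, k+1, k+2 and 0
-- elsewhere, while beyond column a rows k, k+1, k+2 hold x, y and 0.  Adding these
-- multiples of the pivot row clears row k and turns x_m, y_m into
-- y_m - (r/q) x_m = x_{m+1} in row k+1 and 0 - (s/q) x_m = y_{m+1} in row k+2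
-- (with the truncated recurrence in column n); nothing else moves.

open import Defs
open import Level using (Level)
open import Data.Nat using (ℕ; _≤_; pred)
open import Data.Fin using (Fin)
open import Relation.Nullary using (¬_)

open import Data.Bool using (Bool; true; false; T; if_then_else_; _∧_; _∨_)
open import Data.Bool.Properties using (T-∧; T-∨; ∧-comm)
open import Data.Empty using (⊥; ⊥-elim)
open import Data.Fin using (zero; suc; toℕ; fromℕ<)
open import Data.Fin.Properties using (toℕ<n; fromℕ<-toℕ; toℕ-fromℕ<)
open import Data.List using (List; []; _∷_; foldr)
open import Data.List.Relation.Unary.All using (All; []; _∷_)
open import Data.Nat as ℕ using (zero; suc; _<_; _∸_; _≡ᵇ_; _≟_; _%_; ⌊_/2⌋; z≤n; s≤s)
open import Data.Nat.Properties as ℕₚ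
  using (≡ᵇ⇒≡; ≡⇒≡ᵇ; ≤ᵇ⇒≤; ≤⇒≤ᵇ; ≤-refl; ≤-trans; <⇒≤; <-asym; <⇒≱;
         1+n≢n; 1+n≰n; m≢1+n+m;
         m∸n≤m; n≤1+n; m+n≤o⇒m≤o∸n; m+n≤o⇒n≤o)
open import Data.Nat.Tactic.RingSolver using (solve-∀)
open import Data.Product using (_×_; _,_; proj₁)
open import Data.Sum using (inj₁; inj₂)
open import Data.Unit using (tt)
open import Function using (_$_)
open import Function.Bundles using (module Equivalence)
open import Relation.Nullary using (yes; no)
open import Relation.Binary.PropositionalEquality as ≡ using (_≡_; _≢_; refl)
import Algebra.Properties.AbelianGroup as AbelianGroupProperties
import Algebra.Properties.Ring as RingProperties
import Algebra.Solver.Ring.NaturalCoefficients.Default as NaturalCoefficients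

≡ᵇ-true⇒≡ : ∀ {m n} → (m ≡ᵇ n) ≡ true → m ≡ n
≡ᵇ-true⇒≡ {m} {n} e = ≡ᵇ⇒≡ m n (≡.subst T (≡.sym e) tt)

module _ {a} {A : Set a} {u v : A} where

  take : ∀ {b} → T b → (if b then u else v) ≡ u
  take {true} _ = refl

  skip : ∀ {b w} → ¬ T b → v ≡ w → (if b then u else v) ≡ w
  skip {false} _ v≡w = v≡w
  skip {true}  ¬b _  = ⊥-elim (¬b tt)

∧-T : ∀ {a b} → T a → T b → T (a ∧ b)
∧-T ta tb = Equivalence.from T-∧ (ta , tb)

inRange-T : ∀ {lo J hi} → lo ≤ J → J ≤ hi → T (inRange lo J hi)
inRange-T lo≤J J≤hi = ∧-T (≤⇒≤ᵇ lo≤J) (≤⇒≤ᵇ J≤hi)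

band-T : ∀ I {lo J hi} → lo ≤ J → J ≤ hi → T ((I ≡ᵇ I) ∧ inRange lo J hi)
band-T I lo≤J J≤hi = ∧-T (≡⇒≡ᵇ I I refl) (inRange-T lo≤J J≤hi)

band-¬ : ∀ {I A lo J hi} → (I ≡ A → lo ≤ J → J ≤ hi → ⊥) → ¬ T ((I ≡ᵇ A) ∧ inRange lo J hi)
band-¬ {I} {A} {lo} {J} {hi} h t with Equivalence.to T-∧ t
... | I≡A , inR with Equivalence.to T-∧ inR
... | lo≤J , J≤hi = h (≡ᵇ⇒≡ I A I≡A) (≤ᵇ⇒≤ lo J lo≤J) (≤ᵇ⇒≤ J hi J≤hi)

band-¬-range : ∀ I {lo J hi} → (lo ≤ J → J ≤ hi → ⊥) → ¬ T ((I ≡ᵇ I) ∧ inRange lo J hi)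
band-¬-range I h = band-¬ {I} (λ _ → h)

band-¬≢ : ∀ {I A b} → I ≢ A → ¬ T ((I ≡ᵇ A) ∧ b)
band-¬≢ {I} {A} I≢A t = I≢A (≡ᵇ⇒≡ I A (proj₁ (Equivalence.to T-∧ t)))

corner-T₁ : ∀ I J → T (((I ≡ᵇ I) ∧ (J ≡ᵇ J)) ∨ ((I ≡ᵇ J) ∧ (J ≡ᵇ I)))
corner-T₁ I J = Equivalence.from T-∨ (inj₁ (∧-T (≡⇒≡ᵇ I I refl) (≡⇒≡ᵇ J J refl)))

corner-T₂ : ∀ I J → T (((I ≡ᵇ J) ∧ (J ≡ᵇ I)) ∨ ((I ≡ᵇ I) ∧ (J ≡ᵇ J)))
corner-T₂ I J = Equivalence.from T-∨ (inj₂ (∧-T (≡⇒≡ᵇ I I refl) (≡⇒≡ᵇ J J refl)))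

corner-¬ : ∀ I J A B → (I ≡ A → J ≡ B → ⊥) → (I ≡ B → J ≡ A → ⊥) →
           ¬ T (((I ≡ᵇ A) ∧ (J ≡ᵇ B)) ∨ ((I ≡ᵇ B) ∧ (J ≡ᵇ A)))
corner-¬ I J A B h₁ h₂ t with Equivalence.to T-∨ t
... | inj₁ t₁ = let (I≡A , J≡B) = Equivalence.to T-∧ t₁ in
                h₁ (≡ᵇ⇒≡ I A I≡A) (≡ᵇ⇒≡ J B J≡B)
... | inj₂ t₂ = let (I≡B , J≡A) = Equivalence.to T-∧ t₂ in
                h₂ (≡ᵇ⇒≡ I B I≡B) (≡ᵇ⇒≡ J A J≡A)

<⇒≤∸1 : ∀ {m n} → m < n → m ≤ n ∸ 1
<⇒≤∸1 {n = suc n} (s≤s m≤n) = m≤n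

n≰n∸1 : ∀ {n} → 1 ≤ n → ¬ n ≤ n ∸ 1
n≰n∸1 {suc n} _ = 1+n≰n

2+n≢n : ∀ {n} → suc (suc n) ≢ n
2+n≢n {n} e = m≢1+n+m n (≡.sym e)

-- The rows k, k+1, k+2 changed at level k lie strictly before the column band n-k, …, n.
Separated : ℕ → ℕ → Set
Separated n k = 3 ℕ.+ k ℕ.+ k ≤ n

Separated-pred : ∀ {n} k → Separated n (suc k) → Separated n k
Separated-pred k = ≤-trans (ℕₚ.+-mono-≤ (n≤1+n (3 ℕ.+ k)) (n≤1+n k))

Rows : ℕ → ℕ → Set
Rows k I = k ≤ I × I ≤ suc (suc k)

module _ {k I : ℕ} where

  rows₀ : I ≡ k → Rows k I
  rows₀ refl = ≤-refl , ≤-trans (n≤1+n k) (n≤1+n (suc k))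

  rows₁ : I ≡ suc k → Rows k I
  rows₁ refl = n≤1+n k , n≤1+n (suc k)

  rows₂ : I ≡ suc (suc k) → Rows k I
  rows₂ refl = ≤-trans (n≤1+n k) (n≤1+n (suc k)) , ≤-refl

¬Rows : ∀ {k I} → I ≢ k → I ≢ suc k → I ≢ suc (suc k) → ¬ Rows k I
¬Rows I≢k I≢1+k I≢2+k (k≤I , I≤2+k) with ℕₚ.m≤n⇒m<n∨m≡n I≤2+k
... | inj₂ I≡2+k = I≢2+k I≡2+k
... | inj₁ (s≤s I≤1+k) with ℕₚ.m≤n⇒m<n∨m≡n I≤1+k
...   | inj₂ I≡1+k = I≢1+k I≡1+k
...   | inj₁ (s≤s I≤k) = I≢k (ℕₚ.≤-antisym I≤k k≤I)

3+2k≡1+[k+1]+[k+1] : ∀ k → 3 ℕ.+ k ℕ.+ k ≡ suc ((k ℕ.+ 1) ℕ.+ (k ℕ.+ 1))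
3+2k≡1+[k+1]+[k+1] = solve-∀

4+2k≡[k+2]+[k+2] : ∀ k → suc (3 ℕ.+ k ℕ.+ k) ≡ (k ℕ.+ 2) ℕ.+ (k ℕ.+ 2)
4+2k≡[k+2]+[k+2] = solve-∀

⌊n/2⌋+⌊n/2⌋≤n : ∀ n → ⌊ n /2⌋ ℕ.+ ⌊ n /2⌋ ≤ n
⌊n/2⌋+⌊n/2⌋≤n zero          = z≤n
⌊n/2⌋+⌊n/2⌋≤n (suc zero)    = z≤n
⌊n/2⌋+⌊n/2⌋≤n (suc (suc n)) =
  s≤s (≡.subst (_≤ suc n) (≡.sym (ℕₚ.+-suc _ _)) (s≤s (⌊n/2⌋+⌊n/2⌋≤n n)))

odd⇒⌊n/2⌋+⌊n/2⌋<n : ∀ n → (n % 2 ≡ᵇ 1) ≡ true → suc (⌊ n /2⌋ ℕ.+ ⌊ n /2⌋) ≤ n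
odd⇒⌊n/2⌋+⌊n/2⌋<n (suc zero)    _   = s≤s z≤n
odd⇒⌊n/2⌋+⌊n/2⌋<n (suc (suc n)) odd =
  s≤s (≡.subst (_≤ suc n) (≡.sym (≡.cong suc (ℕₚ.+-suc _ _))) (s≤s (odd⇒⌊n/2⌋+⌊n/2⌋<n n odd)))

0<m≤o∸n⇒m+n≤o : ∀ {k d m} → 1 ≤ k → k ≤ m ∸ d → k ℕ.+ d ≤ m
0<m≤o∸n⇒m+n≤o {k} {d} {m} 1≤k k≤m∸d with d ℕ.≤? m
... | yes d≤m = ℕₚ.m≤o∸n⇒m+n≤o k d≤m k≤m∸d
... | no  d≰m = ⊥-elim (ℕₚ.<⇒≱ 1≤k (≤-trans k≤m∸d (ℕₚ.≤-reflexive m∸d≡0)))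
  where m∸d≡0 = ℕₚ.m≤n⇒m∸n≡0 (<⇒≤ (ℕₚ.≰⇒> d≰m))

n₁-separated : ∀ n {k} → 1 ≤ k → k ≤ n₁ n → Separated n k
n₁-separated n {k} 1≤k k≤n₁ with n % 2 ≡ᵇ 1 in odd
... | true  = ≤-trans (ℕₚ.≤-reflexive (3+2k≡1+[k+1]+[k+1] k))
                      (≤-trans (s≤s (ℕₚ.+-mono-≤ k+1≤ k+1≤)) (odd⇒⌊n/2⌋+⌊n/2⌋<n n odd))
  where k+1≤ = 0<m≤o∸n⇒m+n≤o {d = 1} {m = ⌊ n /2⌋} 1≤k k≤n₁
... | false = ≤-trans (ℕₚ.n≤1+n _) (≤-trans (ℕₚ.≤-reflexive (4+2k≡[k+2]+[k+2] k))
                                            (≤-trans (ℕₚ.+-mono-≤ k+2≤ k+2≤) (⌊n/2⌋+⌊n/2⌋≤n n)))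
  where k+2≤ = 0<m≤o∸n⇒m+n≤o {d = 2} {m = ⌊ n /2⌋} 1≤k k≤n₁

module Matrices {c ℓ} (F : Field c ℓ) where
  open Field F hiding (zero) renaming (refl to ≈-refl; sym to ≈-sym; trans to ≈-trans)
  open Construction F
  open import Relation.Binary.Reasoning.Setoid setoid
  open NaturalCoefficients commutativeSemiring using (solve; _:+_; _:*_; _:=_)

  [_] : Bool → Carrier
  [ b ] = if b then 1# else 0#

  Σ-cong : ∀ m {f g : Fin m → Carrier} → (∀ l → f l ≈ g l) → Σ[ m ] f ≈ Σ[ m ] g
  Σ-cong zero    f≈g = ≈-refl
  Σ-cong (suc m) f≈g = +-cong (f≈g zero) (Σ-cong m (λ l → f≈g (suc l)))

  Σ-+ : ∀ m (f g : Fin m → Carrier) → Σ[ m ] (λ l → f l + g l) ≈ Σ[ m ] f + Σ[ m ] g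
  Σ-+ zero    f g = ≈-sym (+-identityˡ 0#)
  Σ-+ (suc m) f g = ≈-trans (+-congˡ (Σ-+ m (λ l → f (suc l)) (λ l → g (suc l))))
    (solve 4 (λ a b c d → (a :+ b) :+ (c :+ d) := ((a :+ c) :+ (b :+ d))) ≈-refl
      (f zero) (g zero) (Σ[ m ] (λ l → f (suc l))) (Σ[ m ] (λ l → g (suc l))))

  Σ-*ˡ : ∀ m x (f : Fin m → Carrier) → Σ[ m ] (λ l → x * f l) ≈ x * Σ[ m ] f
  Σ-*ˡ zero    x f = ≈-sym (zeroʳ x)
  Σ-*ˡ (suc m) x f = ≈-trans (+-congˡ (Σ-*ˡ m x (λ l → f (suc l)))) (≈-sym (distribˡ x _ _))

  Σ-select : ∀ m (i : Fin m) (f : Fin m → Carrier) → Σ[ m ] (λ l → [ idx l ≡ᵇ idx i ] * f l) ≈ f i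
  Σ-select (suc m) zero f = ≈-trans (+-cong (*-identityˡ (f zero)) (Σ-zero m)) (+-identityʳ _)
    where
    Σ-zero : ∀ m {g : Fin m → Carrier} → Σ[ m ] (λ l → 0# * g l) ≈ 0#
    Σ-zero zero    = ≈-refl
    Σ-zero (suc m) = ≈-trans (+-cong (zeroˡ _) (Σ-zero m)) (+-identityˡ 0#)
  Σ-select (suc m) (suc i) f =
    ≈-trans (+-cong (zeroˡ (f zero)) (Σ-select m i (λ l → f (suc l)))) (+-identityˡ _)

  R-rank-one : ∀ {n} (f : Fin n) {m} x (i l : Fin n) → m ≢ idx f →
               R n (idx f) m x i l ≈ identity i l + [ idx i ≡ᵇ idx f ] * (x * [ idx l ≡ᵇ m ])
  R-rank-one f {m} x i l m≢f with idx i ≡ᵇ idx f in i≡f | idx l ≡ᵇ m in l≡m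
  ... | false | _     = ≈-sym (≈-trans (+-congˡ (zeroˡ _)) (+-identityʳ _))
  ... | true  | false = ≈-sym (≈-trans (+-congˡ (≈-trans (*-identityˡ _) (zeroʳ x))) (+-identityʳ _))
  ... | true  | true  = ≈-sym (begin
      identity i l + 1# * (x * 1#)
        ≈⟨ +-cong (reflexive (skip i≢l refl)) (≈-trans (*-identityˡ _) (*-identityʳ x)) ⟩
      0# + x
        ≈⟨ +-identityˡ x ⟩
      x                            ∎)
    where
    i≢l : ¬ T (idx i ≡ᵇ idx l)
    i≢l t = m≢f (≡.trans (≡.sym (≡ᵇ-true⇒≡ l≡m))
                         (≡.trans (≡.sym (≡ᵇ⇒≡ (idx i) (idx l) t)) (≡ᵇ-true⇒≡ i≡f)))

  IsRowUpdate : ∀ {n} → Matrix n → Fin n → (ℕ → Carrier) → Set ℓ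
  IsRowUpdate S f v = ∀ i j → S i j ≈ identity i j + [ idx i ≡ᵇ idx f ] * v (idx j)

  module _ {n} {S : Matrix n} {f : Fin n} {v : ℕ → Carrier} (S-update : IsRowUpdate S f v) where

    ⊗-row-update : ∀ (X : Matrix n) i j → (X ⊗ S) i j ≈ X i j + X i f * v (idx j)
    ⊗-row-update X i j = begin
        Σ[ n ] (λ l → X i l * S l j)
      ≈⟨ Σ-cong n (λ l → ≈-trans (*-congˡ (S-update l j))
           (solve 4 (λ x d e w → x :* (d :+ e :* w) := (d :* x :+ w :* (e :* x))) ≈-refl
             (X i l) (identity l j) [ idx l ≡ᵇ idx f ] (v (idx j)))) ⟩
        Σ[ n ] (λ l → identity l j * X i l + v (idx j) * ([ idx l ≡ᵇ idx f ] * X i l))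
      ≈⟨ ≈-trans (Σ-+ n _ _) (+-congˡ (Σ-*ˡ n _ _)) ⟩
        Σ[ n ] (λ l → identity l j * X i l) + v (idx j) * Σ[ n ] (λ l → [ idx l ≡ᵇ idx f ] * X i l)
      ≈⟨ +-cong (Σ-select n j (X i)) (≈-trans (*-congˡ (Σ-select n f (X i))) (*-comm _ _)) ⟩
        X i j + X i f * v (idx j) ∎

    transpose-⊗-row-update : ∀ (X : Matrix n) i j → (transpose S ⊗ X) i j ≈ X i j + v (idx i) * X f j
    transpose-⊗-row-update X i j = begin
        Σ[ n ] (λ l → S l i * X l j)
      ≈⟨ Σ-cong n (λ l → ≈-trans (*-congʳ (S-update l i))
           (solve 4 (λ d e w x → (d :+ e :* w) :* x := (d :* x :+ w :* (e :* x))) ≈-refl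
             (identity l i) [ idx l ≡ᵇ idx f ] (v (idx i)) (X l j))) ⟩
        Σ[ n ] (λ l → identity l i * X l j + v (idx i) * ([ idx l ≡ᵇ idx f ] * X l j))
      ≈⟨ ≈-trans (Σ-+ n _ _) (+-congˡ (Σ-*ˡ n _ _)) ⟩
        Σ[ n ] (λ l → identity l i * X l j) + v (idx i) * Σ[ n ] (λ l → [ idx l ≡ᵇ idx f ] * X l j)
      ≈⟨ +-cong (Σ-select n i (λ l → X l j)) (*-congˡ (Σ-select n f (λ l → X l j))) ⟩
        X i j + v (idx i) * X f j ∎

    congruence-row-update : ∀ (P : Matrix n) i j →
      ((transpose S ⊗ P) ⊗ S) i j ≈ P i j + v (idx i) * P f j + (P i f + v (idx i) * P f f) * v (idx j)
    congruence-row-update P i j =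
      ≈-trans (⊗-row-update (transpose S ⊗ P) i j)
        (+-cong (transpose-⊗-row-update P i j) (*-congʳ (transpose-⊗-row-update P i f)))

  R-⊗-row-update : ∀ {n} (f : Fin n) {m} x {M : Matrix n} {u : ℕ → Carrier} → m ≢ idx f →
    IsRowUpdate M f u → IsRowUpdate (R n (idx f) m x ⊗ M) f (λ J → x * [ J ≡ᵇ m ] + u J)
  R-⊗-row-update {n} f {m} x {M} {u} m≢f M-update i j = begin
      (R n (idx f) m x ⊗ M) i j
    ≈⟨ ⊗-row-update {v = u} M-update (R n (idx f) m x) i j ⟩
      R n (idx f) m x i j + R n (idx f) m x i f * u (idx j)
    ≈⟨ +-cong (R-rank-one f x i j m≢f) (*-congʳ R-if) ⟩
      identity i j + e * (x * [ idx j ≡ᵇ m ]) + e * u (idx j)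
    ≈⟨ ≈-trans (+-assoc _ _ _) (+-congˡ (≈-sym (distribˡ e _ _))) ⟩
      identity i j + e * (x * [ idx j ≡ᵇ m ] + u (idx j)) ∎
    where
    e = [ idx i ≡ᵇ idx f ]
    [f≡m]≡0 : [ idx f ≡ᵇ m ] ≡ 0#
    [f≡m]≡0 = skip (λ t → m≢f (≡.sym (≡ᵇ⇒≡ (idx f) m t))) refl
    R-if : R n (idx f) m x i f ≈ e
    R-if = begin
        R n (idx f) m x i f
      ≈⟨ R-rank-one f x i f m≢f ⟩
        e + e * (x * [ idx f ≡ᵇ m ])
      ≈⟨ +-congˡ (*-congˡ (≈-trans (*-congˡ (reflexive [f≡m]≡0)) (zeroʳ x))) ⟩
        e + e * 0#
      ≈⟨ ≈-trans (+-congˡ (zeroʳ e)) (+-identityʳ e) ⟩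
        e ∎

  combination : (ℕ → Carrier) → List ℕ → ℕ → Carrier
  combination c []       J = 0#
  combination c (m ∷ ms) J = c m * [ J ≡ᵇ m ] + combination c ms J

  foldr-R-row-update : ∀ {n a} (f : Fin n) → idx f ≡ a → (c : ℕ → Carrier) {ms : List ℕ} →
    All (_≢ a) ms →
    IsRowUpdate (foldr (λ m acc → R n a m (c m) ⊗ acc) identity ms) f (combination c ms)
  foldr-R-row-update f refl c []                  i j = ≈-sym (≈-trans (+-congˡ (zeroʳ _)) (+-identityʳ _))
  foldr-R-row-update f refl c {m ∷ ms} (m≢f ∷ ms≢f) =
    R-⊗-row-update f (c m) {u = combination c ms} m≢f (foldr-R-row-update f refl c ms≢f)

module Pivot {c ℓ} (F : Field c ℓ) {q t : Field.Carrier F}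
             (q≉0 : ¬ Field._≈_ F q (Field.0# F)) (t≉0 : ¬ Field._≈_ F t (Field.0# F)) where
  open Field F hiding (zero) renaming (refl to ≈-refl; sym to ≈-sym; trans to ≈-trans)
  open RingProperties ring using (-‿distribˡ-*; -‿distribʳ-*; -1*x≈-x)
  open NaturalCoefficients commutativeSemiring using (solve; _:+_; _:*_; _:=_)
  open import Relation.Binary.Reasoning.Setoid setoid

  qt⁻¹ : Carrier
  qt⁻¹ = (q * t) ⁻¹

  q*q⁻¹≈1 : q * q ⁻¹ ≈ 1#
  q*q⁻¹≈1 = ⁻¹-inverse q q≉0

  qt≉0 : ¬ q * t ≈ 0#
  qt≉0 qt≈0 = t≉0 (begin
    t                  ≈⟨ ≈-sym (*-identityˡ t) ⟩
    1# * t             ≈⟨ *-congʳ (≈-sym q*q⁻¹≈1) ⟩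
    q * q ⁻¹ * t       ≈⟨ solve 3 (λ q q' t → q :* q' :* t := q' :* (q :* t)) ≈-refl q (q ⁻¹) t ⟩
    q ⁻¹ * (q * t)     ≈⟨ *-congˡ qt≈0 ⟩
    q ⁻¹ * 0#          ≈⟨ zeroʳ _ ⟩
    0#                 ∎)

  qt⁻¹*t≈q⁻¹ : qt⁻¹ * t ≈ q ⁻¹
  qt⁻¹*t≈q⁻¹ = begin
    qt⁻¹ * t
      ≈⟨ ≈-sym (*-identityʳ _) ⟩
    qt⁻¹ * t * 1#
      ≈⟨ *-congˡ (≈-sym q*q⁻¹≈1) ⟩
    qt⁻¹ * t * (q * q ⁻¹)
      ≈⟨ solve 4 (λ w t q q' → w :* t :* (q :* q') := (q :* t :* w) :* q') ≈-refl qt⁻¹ t q (q ⁻¹) ⟩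
    q * t * qt⁻¹ * q ⁻¹
      ≈⟨ *-congʳ (⁻¹-inverse (q * t) qt≉0) ⟩
    1# * q ⁻¹
      ≈⟨ *-identityˡ _ ⟩
    q ⁻¹ ∎

  eliminate : ∀ a X → (a * t) * (- (X * qt⁻¹)) ≈ (- (a * q ⁻¹)) * X
  eliminate a X = begin
    (a * t) * (- (X * qt⁻¹))
      ≈⟨ ≈-sym (-‿distribʳ-* _ _) ⟩
    - (a * t * (X * qt⁻¹))
      ≈⟨ -‿cong (solve 4 (λ a t X w → a :* t :* (X :* w) := a :* (w :* t) :* X) ≈-refl a t X qt⁻¹) ⟩
    - (a * (qt⁻¹ * t) * X)
      ≈⟨ -‿cong (*-congʳ (*-congˡ qt⁻¹*t≈q⁻¹)) ⟩
    - (a * q ⁻¹ * X)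
      ≈⟨ -‿distribˡ-* _ _ ⟩
    (- (a * q ⁻¹)) * X ∎

  eliminateᵀ : ∀ a X → (- (X * qt⁻¹)) * (a * t) ≈ (- (a * q ⁻¹)) * X
  eliminateᵀ a X = ≈-trans (*-comm _ _) (eliminate a X)

  pivot-cancel : ∀ X → X + (q * t) * (- (X * qt⁻¹)) ≈ 0#
  pivot-cancel X = begin
    X + (q * t) * (- (X * qt⁻¹))  ≈⟨ +-congˡ (eliminate q X) ⟩
    X + (- (q * q ⁻¹)) * X        ≈⟨ +-congˡ (*-congʳ (-‿cong q*q⁻¹≈1)) ⟩
    X + (- 1#) * X                ≈⟨ +-congˡ (-1*x≈-x X) ⟩
    X - X                         ≈⟨ -‿inverseʳ X ⟩
    0#                            ∎

  pivot-cancelᵀ : ∀ X → X + (- (X * qt⁻¹)) * (q * t) ≈ 0#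
  pivot-cancelᵀ X = ≈-trans (+-congˡ (*-comm _ _)) (pivot-cancel X)

  -a/q*-qt≈at : ∀ a → (- (a * q ⁻¹)) * (- (q * t)) ≈ a * t
  -a/q*-qt≈at a = begin
    (- (a * q ⁻¹)) * (- (q * t))
      ≈⟨ ≈-sym (-‿distribˡ-* _ _) ⟩
    - (a * q ⁻¹ * (- (q * t)))
      ≈⟨ -‿cong (≈-sym (-‿distribʳ-* _ _)) ⟩
    - (- (a * q ⁻¹ * (q * t)))
      ≈⟨ ⁻¹-involutive _ ⟩
    a * q ⁻¹ * (q * t)
      ≈⟨ solve 4 (λ a q' q t → a :* q' :* (q :* t) := a :* (q :* q') :* t) ≈-refl a (q ⁻¹) q t ⟩
    a * (q * q ⁻¹) * t
      ≈⟨ *-congʳ (≈-trans (*-congˡ q*q⁻¹≈1) (*-identityʳ a)) ⟩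
    a * t ∎
    where open AbelianGroupProperties +-abelianGroup using (⁻¹-involutive)

module ClosedForm {c ℓ} (F : Field c ℓ) (n : ℕ) (q r s t : Field.Carrier F) where
  open Field F hiding (zero) renaming (refl to ≈-refl; sym to ≈-sym; trans to ≈-trans)
  open Construction F
  open Params n q r s t

  Outside : ℕ → ℕ → ℕ → Set
  Outside k I J = (Rows k I → J < n ∸ k) × (Rows k J → I < n ∸ k)

  expected-outside : ∀ {k I J p} → Outside k I J → expected k I J p ≡ p
  expected-outside {k} {I} {J} (row , col) =
    skip (band-¬ λ I≡k a<J _ → <-asym (row (rows₀ I≡k)) a<J) $
    skip (band-¬ λ J≡k a<I _ → <-asym (col (rows₀ J≡k)) a<I) $
    skip (band-¬ λ I≡1+k a≤J _ → <⇒≱ (row (rows₁ I≡1+k)) a≤J) $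
    skip (band-¬ λ J≡1+k a≤I _ → <⇒≱ (col (rows₁ J≡1+k)) a≤I) $
    skip (band-¬ λ I≡2+k a≤J _ → <⇒≱ (row (rows₂ I≡2+k)) a≤J) $
    skip (band-¬ λ J≡2+k a≤I _ → <⇒≱ (col (rows₂ J≡2+k)) a≤I) $
    skip (corner-¬ I J (suc k) n (λ I≡1+k J≡n → n≮n∸k J≡n (row (rows₁ I≡1+k)))
                                 (λ I≡n J≡1+k → n≮n∸k I≡n (col (rows₁ J≡1+k)))) $
    skip (corner-¬ I J (suc (suc k)) n (λ I≡2+k J≡n → n≮n∸k J≡n (row (rows₂ I≡2+k)))
                                       (λ I≡n J≡2+k → n≮n∸k I≡n (col (rows₂ J≡2+k)))) $
    refl
    where
    n≮n∸k : ∀ {L} → L ≡ n → ¬ L < n ∸ k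
    n≮n∸k refl L<a = <⇒≱ L<a (m∸n≤m n k)

  -- W₁ i j is definitionally w₁ (idx i) (idx j).
  w₁ : ℕ → ℕ → Carrier
  w₁ I J =
    if (I ℕ.+ J ≡ᵇ n) ∧ inRange 2 I (n ∸ 2) ∧ inRange 2 J (n ∸ 2) then q * t
    else if (I ℕ.+ J ≡ᵇ suc n) ∧ inRange 2 I (n ∸ 1) ∧ inRange 2 J (n ∸ 1) then r * t
    else if (I ℕ.+ J ≡ᵇ suc (suc n)) ∧ inRange 2 I n ∧ inRange 2 J n then s * t
    else 0#

  w₁-sym : ∀ I J → w₁ I J ≡ w₁ J I
  w₁-sym I J
    rewrite ℕₚ.+-comm I J
          | ∧-comm (inRange 2 I (n ∸ 2)) (inRange 2 J (n ∸ 2))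
          | ∧-comm (inRange 2 I (n ∸ 1)) (inRange 2 J (n ∸ 1))
          | ∧-comm (inRange 2 I n) (inRange 2 J n) = refl

  module _ (I J : ℕ) where

    w₁-qt : I ℕ.+ J ≡ n → 2 ≤ I → I ≤ n ∸ 2 → 2 ≤ J → J ≤ n ∸ 2 → w₁ I J ≡ q * t
    w₁-qt I+J≡n 2≤I I≤ 2≤J J≤ =
      take (∧-T (≡⇒≡ᵇ _ _ I+J≡n) (∧-T (inRange-T 2≤I I≤) (inRange-T 2≤J J≤)))

    w₁-rt : I ℕ.+ J ≡ suc n → 2 ≤ I → I ≤ n ∸ 1 → 2 ≤ J → J ≤ n ∸ 1 → w₁ I J ≡ r * t
    w₁-rt I+J≡1+n 2≤I I≤ 2≤J J≤ =
      skip (band-¬≢ λ I+J≡n → 1+n≢n (≡.trans (≡.sym I+J≡1+n) I+J≡n)) $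
      take (∧-T (≡⇒≡ᵇ _ _ I+J≡1+n) (∧-T (inRange-T 2≤I I≤) (inRange-T 2≤J J≤)))

    w₁-st : I ℕ.+ J ≡ suc (suc n) → 2 ≤ I → I ≤ n → 2 ≤ J → J ≤ n → w₁ I J ≡ s * t
    w₁-st I+J≡2+n 2≤I I≤ 2≤J J≤ =
      skip (band-¬≢ λ I+J≡n → 2+n≢n (≡.trans (≡.sym I+J≡2+n) I+J≡n)) $
      skip (band-¬≢ λ I+J≡1+n → 1+n≢n (≡.trans (≡.sym I+J≡2+n) I+J≡1+n)) $
      take (∧-T (≡⇒≡ᵇ _ _ I+J≡2+n) (∧-T (inRange-T 2≤I I≤) (inRange-T 2≤J J≤)))

    w₁-zero : I ℕ.+ J ≢ n → I ℕ.+ J ≢ suc n → I ℕ.+ J ≢ suc (suc n) → w₁ I J ≡ 0#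
    w₁-zero ≢n ≢1+n ≢2+n = skip (band-¬≢ ≢n) $ skip (band-¬≢ ≢1+n) $ skip (band-¬≢ ≢2+n) refl

    w₁-far : suc (suc n) < I ℕ.+ J → w₁ I J ≡ 0#
    w₁-far 2+n<I+J = w₁-zero (λ e → <⇒≱ 2+n<I+J (≤-trans (ℕₚ.≤-reflexive e) (ℕₚ.m≤n+m n 2)))
                             (λ e → <⇒≱ 2+n<I+J (≤-trans (ℕₚ.≤-reflexive e) (n≤1+n (suc n))))
                             (λ e → <⇒≱ 2+n<I+J (ℕₚ.≤-reflexive e))

  w : ℕ → ℕ → ℕ → Carrier
  w zero          = w₁
  w (suc zero)    = w₁
  w (suc (suc k)) I J = expected (suc (suc k)) I J (w (suc k) I J)

  w-frame : ∀ k {I J} → (∀ {L} → 2 ≤ L → L ≤ k → Outside L I J) → w k I J ≡ w₁ I J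
  w-frame zero          _       = refl
  w-frame (suc zero)    _       = refl
  w-frame (suc (suc k)) outside =
    ≡.trans (expected-outside (outside (s≤s (s≤s z≤n)) ≤-refl))
            (w-frame (suc k) λ 2≤L L≤1+k → outside 2≤L (ℕₚ.m≤n⇒m≤1+n L≤1+k))

  Outside-sym : ∀ {L I J} → Outside L I J → Outside L J I
  Outside-sym (row , col) = col , row

  outside-¬Rows : ∀ {L I J} → ¬ Rows L I → ¬ Rows L J → Outside L I J
  outside-¬Rows ¬I ¬J = (λ rows → ⊥-elim (¬I rows)) , (λ rows → ⊥-elim (¬J rows))

  outside-far : ∀ {L I J} → suc (suc L) < I → suc (suc L) < J → Outside L I J
  outside-far L+2<I L+2<J = outside-¬Rows (λ (_ , I≤) → <⇒≱ L+2<I I≤) (λ (_ , J≤) → <⇒≱ L+2<J J≤)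

  module AtLevel (k : ℕ) (sep : Separated n k) where

    rows<band : suc (suc (suc k)) ≤ n ∸ k
    rows<band = m+n≤o⇒m≤o∸n (suc (suc (suc k))) sep

    under : ∀ {I} → Rows k I → ¬ n ∸ k ≤ I
    under (_ , I≤2+k) a≤I = 1+n≰n (≤-trans rows<band (≤-trans a≤I I≤2+k))

    n∉Rows : ¬ Rows k n
    n∉Rows rows = under rows (m∸n≤m n k)

    1≤n : 1 ≤ n
    1≤n = ≤-trans (s≤s z≤n) sep

    module _ {p : Carrier} where

      expected-row-zero : ∀ {J} → n ∸ k < J → J ≤ n → expected k k J p ≡ 0#
      expected-row-zero a<J J≤n = take (band-T k a<J J≤n)

      expected-col-zero : ∀ {I} → n ∸ k < I → I ≤ n → expected k I k p ≡ 0#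
      expected-col-zero a<I I≤n =
        skip (band-¬≢ λ I≡k → under (rows₀ I≡k) (<⇒≤ a<I)) $
        take (band-T k a<I I≤n)

      expected-pivot : expected k k (n ∸ k) p ≡ p
      expected-pivot =
        skip (band-¬-range k λ a<a _ → 1+n≰n {n ∸ k} a<a) $
        skip (band-¬≢ λ a≡k → under (rows₀ a≡k) ≤-refl) $
        skip (band-¬≢ λ k≡1+k → 1+n≢n {k} (≡.sym k≡1+k)) $
        skip (band-¬≢ λ a≡1+k → under (rows₁ a≡1+k) ≤-refl) $
        skip (band-¬≢ λ k≡2+k → 2+n≢n {k} (≡.sym k≡2+k)) $
        skip (band-¬≢ λ a≡2+k → under (rows₂ a≡2+k) ≤-refl) $
        skip (corner-¬ k (n ∸ k) (suc k) n (λ k≡1+k _ → 1+n≢n {k} (≡.sym k≡1+k))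
                                           (λ k≡n _ → n∉Rows (rows₀ (≡.sym k≡n)))) $
        skip (corner-¬ k (n ∸ k) (suc (suc k)) n (λ k≡2+k _ → 2+n≢n {k} (≡.sym k≡2+k))
                                                 (λ k≡n _ → n∉Rows (rows₀ (≡.sym k≡n)))) $
        refl

      expected-pivotᵀ : expected k (n ∸ k) k p ≡ p
      expected-pivotᵀ =
        skip (band-¬≢ λ a≡k → under (rows₀ a≡k) ≤-refl) $
        skip (band-¬-range k λ a<a _ → 1+n≰n {n ∸ k} a<a) $
        skip (band-¬≢ λ a≡1+k → under (rows₁ a≡1+k) ≤-refl) $
        skip (band-¬≢ λ k≡1+k → 1+n≢n {k} (≡.sym k≡1+k)) $
        skip (band-¬≢ λ a≡2+k → under (rows₂ a≡2+k) ≤-refl) $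
        skip (band-¬≢ λ k≡2+k → 2+n≢n {k} (≡.sym k≡2+k)) $
        skip (corner-¬ (n ∸ k) k (suc k) n (λ a≡1+k _ → under (rows₁ a≡1+k) ≤-refl)
                                           (λ _ k≡1+k → 1+n≢n {k} (≡.sym k≡1+k))) $
        skip (corner-¬ (n ∸ k) k (suc (suc k)) n (λ a≡2+k _ → under (rows₂ a≡2+k) ≤-refl)
                                                 (λ _ k≡2+k → 2+n≢n {k} (≡.sym k≡2+k))) $
        refl

      expected-row-x : ∀ {J} → n ∸ k ≤ J → J < n → expected k (suc k) J p ≡ x ((J ℕ.+ k ℕ.+ 2) ∸ n)
      expected-row-x a≤J J<n =
        skip (band-¬≢ λ 1+k≡k → 1+n≢n {k} 1+k≡k) $
        skip (band-¬≢ λ J≡k → under (rows₀ J≡k) a≤J) $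
        take (band-T (suc k) a≤J (<⇒≤∸1 J<n))

      expected-col-x : ∀ {I} → n ∸ k ≤ I → I < n → expected k I (suc k) p ≡ x ((I ℕ.+ k ℕ.+ 2) ∸ n)
      expected-col-x a≤I I<n =
        skip (band-¬≢ λ I≡k → under (rows₀ I≡k) a≤I) $
        skip (band-¬≢ λ 1+k≡k → 1+n≢n {k} 1+k≡k) $
        skip (band-¬≢ λ I≡1+k → under (rows₁ I≡1+k) a≤I) $
        take (band-T (suc k) a≤I (<⇒≤∸1 I<n))

      expected-row-y : ∀ {J} → n ∸ k ≤ J → J < n →
                       expected k (suc (suc k)) J p ≡ y ((J ℕ.+ k ℕ.+ 2) ∸ n)
      expected-row-y a≤J J<n =
        skip (band-¬≢ λ 2+k≡k → 2+n≢n {k} 2+k≡k) $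
        skip (band-¬≢ λ J≡k → under (rows₀ J≡k) a≤J) $
        skip (band-¬≢ λ 2+k≡1+k → 1+n≢n {suc k} 2+k≡1+k) $
        skip (band-¬≢ λ J≡1+k → under (rows₁ J≡1+k) a≤J) $
        take (band-T (suc (suc k)) a≤J (<⇒≤∸1 J<n))

      expected-col-y : ∀ {I} → n ∸ k ≤ I → I < n →
                       expected k I (suc (suc k)) p ≡ y ((I ℕ.+ k ℕ.+ 2) ∸ n)
      expected-col-y a≤I I<n =
        skip (band-¬≢ λ I≡k → under (rows₀ I≡k) a≤I) $
        skip (band-¬≢ λ 2+k≡k → 2+n≢n {k} 2+k≡k) $
        skip (band-¬≢ λ I≡1+k → under (rows₁ I≡1+k) a≤I) $
        skip (band-¬≢ λ 2+k≡1+k → 1+n≢n {suc k} 2+k≡1+k) $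
        skip (band-¬≢ λ I≡2+k → under (rows₂ I≡2+k) a≤I) $
        take (band-T (suc (suc k)) a≤I (<⇒≤∸1 I<n))

      expected-corner-x : expected k (suc k) n p ≡ - (s * x k * q ⁻¹)
      expected-corner-x =
        skip (band-¬≢ λ 1+k≡k → 1+n≢n {k} 1+k≡k) $
        skip (band-¬≢ λ n≡k → n∉Rows (rows₀ n≡k)) $
        skip (band-¬-range (suc k) λ (_ : n ∸ k ≤ n) n≤n∸1 → n≰n∸1 1≤n n≤n∸1) $
        skip (band-¬≢ λ n≡1+k → n∉Rows (rows₁ n≡1+k)) $
        skip (band-¬≢ λ 1+k≡2+k → 1+n≢n {suc k} (≡.sym 1+k≡2+k)) $
        skip (band-¬≢ λ n≡2+k → n∉Rows (rows₂ n≡2+k)) $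
        take (corner-T₁ (suc k) n)

      expected-corner-xᵀ : expected k n (suc k) p ≡ - (s * x k * q ⁻¹)
      expected-corner-xᵀ =
        skip (band-¬≢ λ n≡k → n∉Rows (rows₀ n≡k)) $
        skip (band-¬≢ λ 1+k≡k → 1+n≢n {k} 1+k≡k) $
        skip (band-¬≢ λ n≡1+k → n∉Rows (rows₁ n≡1+k)) $
        skip (band-¬-range (suc k) λ (_ : n ∸ k ≤ n) n≤n∸1 → n≰n∸1 1≤n n≤n∸1) $
        skip (band-¬≢ λ n≡2+k → n∉Rows (rows₂ n≡2+k)) $
        skip (band-¬≢ λ 1+k≡2+k → 1+n≢n {suc k} (≡.sym 1+k≡2+k)) $
        take (corner-T₂ n (suc k))

      expected-corner-y : expected k (suc (suc k)) n p ≡ - (s * y k * q ⁻¹)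
      expected-corner-y =
        skip (band-¬≢ λ 2+k≡k → 2+n≢n {k} 2+k≡k) $
        skip (band-¬≢ λ n≡k → n∉Rows (rows₀ n≡k)) $
        skip (band-¬≢ λ 2+k≡1+k → 1+n≢n {suc k} 2+k≡1+k) $
        skip (band-¬≢ λ n≡1+k → n∉Rows (rows₁ n≡1+k)) $
        skip (band-¬-range (suc (suc k)) λ (_ : n ∸ k ≤ n) n≤n∸1 → n≰n∸1 1≤n n≤n∸1) $
        skip (band-¬≢ λ n≡2+k → n∉Rows (rows₂ n≡2+k)) $
        skip (corner-¬ (suc (suc k)) n (suc k) n (λ 2+k≡1+k _ → 1+n≢n {suc k} 2+k≡1+k)
                                                 (λ 2+k≡n _ → n∉Rows (rows₂ (≡.sym 2+k≡n)))) $
        take (corner-T₁ (suc (suc k)) n)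

      expected-corner-yᵀ : expected k n (suc (suc k)) p ≡ - (s * y k * q ⁻¹)
      expected-corner-yᵀ =
        skip (band-¬≢ λ n≡k → n∉Rows (rows₀ n≡k)) $
        skip (band-¬≢ λ 2+k≡k → 2+n≢n {k} 2+k≡k) $
        skip (band-¬≢ λ n≡1+k → n∉Rows (rows₁ n≡1+k)) $
        skip (band-¬≢ λ 2+k≡1+k → 1+n≢n {suc k} 2+k≡1+k) $
        skip (band-¬≢ λ n≡2+k → n∉Rows (rows₂ n≡2+k)) $
        skip (band-¬-range (suc (suc k)) λ (_ : n ∸ k ≤ n) n≤n∸1 → n≰n∸1 1≤n n≤n∸1) $
        skip (corner-¬ n (suc (suc k)) (suc k) n (λ n≡1+k _ → n∉Rows (rows₁ n≡1+k))
                                                 (λ _ 2+k≡1+k → 1+n≢n {suc k} 2+k≡1+k)) $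
        take (corner-T₂ n (suc (suc k)))

    pivot+k≡n : n ∸ k ℕ.+ k ≡ n
    pivot+k≡n = ℕₚ.m∸n+n≡m (m+n≤o⇒n≤o (3 ℕ.+ k) sep)

    2+k≤n : suc (suc k) ≤ n
    2+k≤n = ≤-trans (n≤1+n _) (≤-trans (ℕₚ.m≤m+n (3 ℕ.+ k) k) sep)

    outside-pivot : ∀ {L J} → L < k → Outside L (n ∸ k) J
    outside-pivot L<k = (λ (_ , a≤L+2) → ⊥-elim (<⇒≱ L+2<a a≤L+2)) , (λ _ → ℕₚ.∸-monoʳ-< L<k k≤n)
      where
      L+2<a = ≤-trans (s≤s (s≤s L<k)) (≤-trans (n≤1+n _) rows<band)
      k≤n = ≤-trans (n≤1+n k) (≤-trans (n≤1+n _) 2+k≤n)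

    pivot+1+k≡1+n : n ∸ k ℕ.+ suc k ≡ suc n
    pivot+1+k≡1+n = ≡.trans (ℕₚ.+-suc _ k) (≡.cong suc pivot+k≡n)

    pivot+2+k≡2+n : n ∸ k ℕ.+ suc (suc k) ≡ suc (suc n)
    pivot+2+k≡2+n = ≡.trans (ℕₚ.+-suc _ (suc k)) (≡.cong suc pivot+1+k≡1+n)

    w₁-pivot-zero : ∀ {J} → ¬ Rows k J → w₁ (n ∸ k) J ≡ 0#
    w₁-pivot-zero ¬rows =
      w₁-zero (n ∸ k) _ (λ e → ¬rows (rows₀ (cancel (≡.trans e (≡.sym pivot+k≡n)))))
                        (λ e → ¬rows (rows₁ (cancel (≡.trans e (≡.sym pivot+1+k≡1+n)))))
                        (λ e → ¬rows (rows₂ (cancel (≡.trans e (≡.sym pivot+2+k≡2+n)))))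
      where
      cancel : ∀ {J K} → n ∸ k ℕ.+ J ≡ n ∸ k ℕ.+ K → J ≡ K
      cancel = ℕₚ.+-cancelˡ-≡ (n ∸ k) _ _

    module _ (2≤k : 2 ≤ k) where

      private
        2≤a : 2 ≤ n ∸ k
        2≤a = ≤-trans 2≤k (≤-trans (n≤1+n k) (≤-trans (n≤1+n _) (≤-trans (n≤1+n _) rows<band)))

      w₁-pivot : w₁ (n ∸ k) k ≡ q * t
      w₁-pivot = w₁-qt (n ∸ k) k pivot+k≡n 2≤a (ℕₚ.∸-monoʳ-≤ n 2≤k)
                       2≤k (m+n≤o⇒m≤o∸n k (≤-trans (ℕₚ.≤-reflexive (ℕₚ.+-comm k 2)) 2+k≤n))

      w₁-pivot₁ : w₁ (n ∸ k) (suc k) ≡ r * t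
      w₁-pivot₁ = w₁-rt (n ∸ k) (suc k) pivot+1+k≡1+n 2≤a (ℕₚ.∸-monoʳ-≤ n (≤-trans (n≤1+n 1) 2≤k))
                        (≤-trans 2≤k (n≤1+n k))
                        (m+n≤o⇒m≤o∸n (suc k) (≤-trans (ℕₚ.≤-reflexive (ℕₚ.+-comm (suc k) 1)) 2+k≤n))

      w₁-pivot₂ : w₁ (n ∸ k) (suc (suc k)) ≡ s * t
      w₁-pivot₂ = w₁-st (n ∸ k) (suc (suc k)) pivot+2+k≡2+n 2≤a (m∸n≤m n k)
                        (≤-trans 2≤k (≤-trans (n≤1+n k) (n≤1+n _))) 2+k≤n

  module _ (k J : ℕ) where

    outside-zero-row : Separated n k → n ∸ k ≤ J → ∀ {L} → L ≤ k → Outside L (3 ℕ.+ k) J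
    outside-zero-row sep a≤J L≤k = outside-far L+2<3+k (≤-trans L+2<3+k (≤-trans rows<band a≤J))
      where
      open AtLevel k sep using (rows<band)
      L+2<3+k = s≤s (s≤s (s≤s L≤k))

    w₁-zero-row : n ∸ k ≤ J → w₁ (3 ℕ.+ k) J ≡ 0#
    w₁-zero-row a≤J =
      w₁-far (3 ℕ.+ k) J (s≤s (s≤s (s≤s (≤-trans (ℕₚ.m≤n+m∸n n k) (ℕₚ.+-monoʳ-≤ k a≤J)))))

    w-zero-row : Separated n k → n ∸ k ≤ J → w k (3 ℕ.+ k) J ≡ 0#
    w-zero-row sep a≤J = ≡.trans (w-frame k (λ _ → outside-zero-row sep a≤J)) (w₁-zero-row a≤J)

    w-zero-col : Separated n k → n ∸ k ≤ J → w k J (3 ℕ.+ k) ≡ 0#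
    w-zero-col sep a≤J =
      ≡.trans (w-frame k (λ _ L≤k → Outside-sym (outside-zero-row sep a≤J L≤k)))
              (≡.trans (w₁-sym J (3 ℕ.+ k)) (w₁-zero-row a≤J))

    w-pivot-row : Separated n (suc k) → w k (n ∸ suc k) J ≡ w₁ (n ∸ suc k) J
    w-pivot-row sep = w-frame k (λ _ L≤k → AtLevel.outside-pivot (suc k) sep (s≤s L≤k))

    w-pivot-col : Separated n (suc k) → w k J (n ∸ suc k) ≡ w₁ J (n ∸ suc k)
    w-pivot-col sep = w-frame k (λ _ L≤k → Outside-sym (AtLevel.outside-pivot (suc k) sep (s≤s L≤k)))

module Elimination {c ℓ} (F : Field c ℓ) (n : ℕ) (q r s t : Field.Carrier F)
             (q≉0 : ¬ Field._≈_ F q (Field.0# F)) (t≉0 : ¬ Field._≈_ F t (Field.0# F)) where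
  open Field F hiding (zero) renaming (refl to ≈-refl; sym to ≈-sym; trans to ≈-trans)
  open RingProperties ring using (-‿distribˡ-*; -‿distribʳ-*)
  open AbelianGroupProperties +-abelianGroup using (⁻¹-∙-comm; ε⁻¹≈ε)
  open NaturalCoefficients commutativeSemiring using (solve; _:+_; _:*_; _:=_)
  open import Relation.Binary.Reasoning.Setoid setoid
  open Construction F
  open Params n q r s t
  open Pivot F q≉0 t≉0
  open ClosedForm F n q r s t

  +-killˡ : ∀ {X Y Z} → Y ≈ 0# → X + Y * Z ≈ X
  +-killˡ Y≈0 = ≈-trans (+-congˡ (≈-trans (*-congʳ Y≈0) (zeroˡ _))) (+-identityʳ _)

  +-killʳ : ∀ {X Y Z} → Y ≈ 0# → X + Z * Y ≈ X
  +-killʳ Y≈0 = ≈-trans (+-congˡ (≈-trans (*-congˡ Y≈0) (zeroʳ _))) (+-identityʳ _)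

  x-from-y : ∀ m → 1 ≤ m → x (suc m) ≈ y m + (- (r * q ⁻¹)) * x m
  x-from-y (suc zero)    _ = ≈-sym (≈-trans (+-identityˡ _) (-a/q*-qt≈at r))
  x-from-y (suc (suc m)) _ = +-comm _ _

  y-from-x : ∀ m → 1 ≤ m → y (suc m) ≡ (- (s * q ⁻¹)) * x m
  y-from-x (suc m) _ = refl

  y₂≈st : y 2 ≈ s * t
  y₂≈st = -a/q*-qt≈at s

  corner-x₁≈st : - (s * x 1 * q ⁻¹) ≈ s * t
  corner-x₁≈st = begin
    - (s * (- (q * t)) * q ⁻¹)
      ≈⟨ -‿cong (solve 3 (λ s N q' → s :* N :* q' := s :* q' :* N) ≈-refl s _ (q ⁻¹)) ⟩
    - (s * q ⁻¹ * (- (q * t)))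
      ≈⟨ -‿distribˡ-* _ _ ⟩
    (- (s * q ⁻¹)) * (- (q * t))
      ≈⟨ -a/q*-qt≈at s ⟩
    s * t ∎

  corner-y₁≈0 : - (s * y 1 * q ⁻¹) ≈ 0#
  corner-y₁≈0 = ≈-trans (-‿cong (≈-trans (*-congʳ (zeroʳ s)) (zeroˡ _))) ε⁻¹≈ε

  scale-corner : ∀ a X → a * (- (s * X * q ⁻¹)) ≈ - (s * (a * X) * q ⁻¹)
  scale-corner a X = ≈-trans (≈-sym (-‿distribʳ-* _ _))
    (-‿cong (solve 4 (λ a s X q' → a :* (s :* X :* q') := s :* (a :* X) :* q') ≈-refl a s X (q ⁻¹)))

  corner-sum : ∀ Y a X → - (s * Y * q ⁻¹) + a * (- (s * X * q ⁻¹)) ≈ - (s * (Y + a * X) * q ⁻¹)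
  corner-sum Y a X = begin
    - (s * Y * q ⁻¹) + a * (- (s * X * q ⁻¹))
      ≈⟨ +-congˡ (scale-corner a X) ⟩
    - (s * Y * q ⁻¹) + - (s * (a * X) * q ⁻¹)
      ≈⟨ ⁻¹-∙-comm _ _ ⟩
    - (s * Y * q ⁻¹ + s * (a * X) * q ⁻¹)
      ≈⟨ -‿cong (solve 4 (λ s Y Z q' → s :* Y :* q' :+ s :* Z :* q' := s :* (Y :+ Z) :* q')
                         ≈-refl s Y (a * X) (q ⁻¹)) ⟩
    - (s * (Y + a * X) * q ⁻¹) ∎

  -- What the elimination at level k + 1 uses about D = W(t)_k, in 1-based indices.
  record Shape (k : ℕ) (D : ℕ → ℕ → Carrier) : Set ℓ where
    field
      x-row     : ∀ {J} → n ∸ k ≤ J → J < n → D (suc k) J ≈ x ((J ℕ.+ k ℕ.+ 2) ∸ n)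
      x-col     : ∀ {I} → n ∸ k ≤ I → I < n → D I (suc k) ≈ x ((I ℕ.+ k ℕ.+ 2) ∸ n)
      y-row     : ∀ {J} → n ∸ k ≤ J → J < n → D (suc (suc k)) J ≈ y ((J ℕ.+ k ℕ.+ 2) ∸ n)
      y-col     : ∀ {I} → n ∸ k ≤ I → I < n → D I (suc (suc k)) ≈ y ((I ℕ.+ k ℕ.+ 2) ∸ n)
      x-corner  : D (suc k) n ≈ - (s * x k * q ⁻¹)
      x-cornerᵀ : D n (suc k) ≈ - (s * x k * q ⁻¹)
      y-corner  : D (suc (suc k)) n ≈ - (s * y k * q ⁻¹)
      y-cornerᵀ : D n (suc (suc k)) ≈ - (s * y k * q ⁻¹)
      zero-row  : ∀ {J} → n ∸ k ≤ J → D (3 ℕ.+ k) J ≈ 0#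
      zero-col  : ∀ {I} → n ∸ k ≤ I → D I (3 ℕ.+ k) ≈ 0#
      pivot-row : ∀ J → D (n ∸ suc k) J ≈ w₁ (n ∸ suc k) J
      pivot-col : ∀ I → D I (n ∸ suc k) ≈ w₁ I (n ∸ suc k)

  shape : ∀ k → 1 ≤ k → Separated n (suc k) → Shape k (w k)
  shape (suc zero) _ sep = record
    { x-row     = x-row₁
    ; x-col     = λ a≤I I<n → ≈-trans (reflexive (w₁-sym _ 2)) (x-row₁ a≤I I<n)
    ; y-row     = y-row₁
    ; y-col     = λ a≤I I<n → ≈-trans (reflexive (w₁-sym _ 3)) (y-row₁ a≤I I<n)
    ; x-corner  = ≈-trans (reflexive (w₁-st 2 n refl ≤-refl 2≤n 2≤n ≤-refl)) (≈-sym corner-x₁≈st)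
    ; x-cornerᵀ = ≈-trans (reflexive (w₁-st n 2 (ℕₚ.+-comm n 2) 2≤n ≤-refl ≤-refl 2≤n)) (≈-sym corner-x₁≈st)
    ; y-corner  = ≈-trans (reflexive (w₁-far 3 n ≤-refl)) (≈-sym corner-y₁≈0)
    ; y-cornerᵀ = ≈-trans (reflexive (w₁-far n 3 (ℕₚ.≤-reflexive (ℕₚ.+-comm 3 n)))) (≈-sym corner-y₁≈0)
    ; zero-row  = λ {J} a≤J → reflexive (w-zero-row 1 J (Separated-pred 1 sep) a≤J)
    ; zero-col  = λ {I} a≤I → reflexive (w-zero-col 1 I (Separated-pred 1 sep) a≤I)
    ; pivot-row = λ J → reflexive (w-pivot-row 1 J sep)
    ; pivot-col = λ I → reflexive (w-pivot-col 1 I sep)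
    }
    where
    2≤n : 2 ≤ n
    2≤n = ≤-trans (s≤s (s≤s z≤n)) sep
    2≤n∸1 : 2 ≤ n ∸ 1
    2≤n∸1 = m+n≤o⇒m≤o∸n 2 (≤-trans (s≤s (s≤s (s≤s z≤n))) sep)
    last : ∀ {J} → n ∸ 1 ≤ J → J < n → suc J ≡ n
    last a≤J J<n = ℕₚ.≤-antisym J<n (≤-trans (ℕₚ.m≤n+m∸n n 1) (s≤s a≤J))
    2≤J : ∀ {J} → n ∸ 1 ≤ J → 2 ≤ J
    2≤J a≤J = ≤-trans 2≤n∸1 a≤J
    index₂ : ∀ {J} → n ∸ 1 ≤ J → J < n → (J ℕ.+ 1 ℕ.+ 2) ∸ n ≡ 2
    index₂ {J} a≤J J<n =
      ≡.trans (≡.cong (λ m → m ℕ.+ 2 ∸ n) (≡.trans (ℕₚ.+-comm J 1) (last a≤J J<n))) (ℕₚ.m+n∸m≡n n 2)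
    x-row₁ : ∀ {J} → n ∸ 1 ≤ J → J < n → w₁ 2 J ≈ x ((J ℕ.+ 1 ℕ.+ 2) ∸ n)
    x-row₁ {J} a≤J J<n =
      reflexive (≡.trans (w₁-rt 2 J (≡.cong suc (last a≤J J<n)) ≤-refl 2≤n∸1 (2≤J a≤J) (<⇒≤∸1 J<n))
                         (≡.cong x (≡.sym (index₂ a≤J J<n))))
    y-row₁ : ∀ {J} → n ∸ 1 ≤ J → J < n → w₁ 3 J ≈ y ((J ℕ.+ 1 ℕ.+ 2) ∸ n)
    y-row₁ {J} a≤J J<n = begin
      w₁ 3 J
        ≡⟨ w₁-st 3 J (≡.cong (λ m → suc (suc m)) (last a≤J J<n)) (s≤s (s≤s z≤n)) 3≤n (2≤J a≤J) (<⇒≤ J<n) ⟩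
      s * t
        ≈⟨ ≈-sym y₂≈st ⟩
      y 2
        ≡⟨ ≡.cong y (≡.sym (index₂ a≤J J<n)) ⟩
      y ((J ℕ.+ 1 ℕ.+ 2) ∸ n) ∎
      where 3≤n = ≤-trans (s≤s (s≤s (s≤s z≤n))) sep
  shape (suc (suc j)) _ sep = record
    { x-row     = λ a≤J J<n → reflexive (expected-row-x a≤J J<n)
    ; x-col     = λ a≤I I<n → reflexive (expected-col-x a≤I I<n)
    ; y-row     = λ a≤J J<n → reflexive (expected-row-y a≤J J<n)
    ; y-col     = λ a≤I I<n → reflexive (expected-col-y a≤I I<n)
    ; x-corner  = reflexive expected-corner-x
    ; x-cornerᵀ = reflexive expected-corner-xᵀ
    ; y-corner  = reflexive expected-corner-y
    ; y-cornerᵀ = reflexive expected-corner-yᵀ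
    ; zero-row  = λ {J} a≤J → reflexive (w-zero-row (suc (suc j)) J (Separated-pred (suc (suc j)) sep) a≤J)
    ; zero-col  = λ {I} a≤I → reflexive (w-zero-col (suc (suc j)) I (Separated-pred (suc (suc j)) sep) a≤I)
    ; pivot-row = λ J → reflexive (w-pivot-row (suc (suc j)) J sep)
    ; pivot-col = λ I → reflexive (w-pivot-col (suc (suc j)) I sep)
    }
    where open AtLevel (suc (suc j)) (Separated-pred (suc (suc j)) sep)

  module Step {k : ℕ} (1≤k : 1 ≤ k) (sep : Separated n (suc k))
              {D : ℕ → ℕ → Carrier} (D-shape : Shape k D) {v : ℕ → Carrier}
              (v-band : ∀ {J} → n ∸ suc k < J → J ≤ n → v J ≈ - (D (suc k) J * qt⁻¹))
              (v-off : ∀ {J} → J ≤ n ∸ suc k → v J ≈ 0#) where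
    open Shape D-shape
    open AtLevel (suc k) sep

    μ excess : ℕ → ℕ
    μ J = (J ℕ.+ k ℕ.+ 2) ∸ n
    excess J = J ℕ.+ k ∸ n

    module _ {J : ℕ} (a<J : n ∸ suc k < J) where

      n≤J+k : n ≤ J ℕ.+ k
      n≤J+k = ≤-trans (ℕₚ.≤-reflexive (≡.trans (≡.sym pivot+k≡n) (ℕₚ.+-suc _ k)))
                      (ℕₚ.+-monoˡ-≤ k a<J)

      band-start : n ∸ k ≤ J
      band-start = ≤-trans (ℕₚ.∸-monoˡ-≤ k n≤J+k) (ℕₚ.≤-reflexive (ℕₚ.m+n∸n≡m J k))

      offset : μ J ≡ 2 ℕ.+ excess J
      offset = ≡.trans (ℕₚ.+-∸-comm 2 n≤J+k) (ℕₚ.+-comm (excess J) 2)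

      offset⁺ : (J ℕ.+ suc k ℕ.+ 2) ∸ n ≡ 3 ℕ.+ excess J
      offset⁺ = ≡.trans (≡.cong (λ i → i ℕ.+ 2 ∸ n) (ℕₚ.+-suc J k))
                        (≡.trans (ℕₚ.+-∸-assoc 1 (≤-trans n≤J+k (ℕₚ.m≤m+n _ 2))) (≡.cong suc offset))

    pivot-offset : (n ∸ suc k ℕ.+ suc k ℕ.+ 2) ∸ n ≡ 2
    pivot-offset = ≡.trans (≡.cong (λ i → i ℕ.+ 2 ∸ n) pivot+k≡n) (ℕₚ.m+n∸m≡n n 2)

    pivot<n : n ∸ suc k < n
    pivot<n = ℕₚ.∸-monoʳ-< {o = 0} (s≤s z≤n) (≤-trans (ℕₚ.n≤1+n _) (≤-trans (ℕₚ.n≤1+n _) 2+k≤n))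

    2≤K : 2 ≤ suc k
    2≤K = s≤s 1≤k

    D-pivot : D (suc k) (n ∸ suc k) ≈ q * t
    D-pivot = ≈-trans (pivot-col (suc k)) (reflexive (≡.trans (w₁-sym (suc k) _) (w₁-pivot 2≤K)))

    D-pivotᵀ : D (n ∸ suc k) (suc k) ≈ q * t
    D-pivotᵀ = ≈-trans (pivot-row (suc k)) (reflexive (w₁-pivot 2≤K))

    D-pivot₁ : D (2 ℕ.+ k) (n ∸ suc k) ≈ r * t
    D-pivot₁ = ≈-trans (pivot-col (2 ℕ.+ k))
                       (reflexive (≡.trans (w₁-sym (2 ℕ.+ k) _) (w₁-pivot₁ 2≤K)))

    D-pivot₁ᵀ : D (n ∸ suc k) (2 ℕ.+ k) ≈ r * t
    D-pivot₁ᵀ = ≈-trans (pivot-row (2 ℕ.+ k)) (reflexive (w₁-pivot₁ 2≤K))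

    D-pivot₂ : D (3 ℕ.+ k) (n ∸ suc k) ≈ s * t
    D-pivot₂ = ≈-trans (pivot-col (3 ℕ.+ k))
                       (reflexive (≡.trans (w₁-sym (3 ℕ.+ k) _) (w₁-pivot₂ 2≤K)))

    D-pivot₂ᵀ : D (n ∸ suc k) (3 ℕ.+ k) ≈ s * t
    D-pivot₂ᵀ = ≈-trans (pivot-row (3 ℕ.+ k)) (reflexive (w₁-pivot₂ 2≤K))

    D-pivot-row-zero : ∀ {J} → ¬ Rows (suc k) J → D (n ∸ suc k) J ≈ 0#
    D-pivot-row-zero {J} ¬rows = ≈-trans (pivot-row J) (reflexive (w₁-pivot-zero ¬rows))

    D-pivot-col-zero : ∀ {I} → ¬ Rows (suc k) I → D I (n ∸ suc k) ≈ 0#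
    D-pivot-col-zero {I} ¬rows =
      ≈-trans (pivot-col I) (reflexive (≡.trans (w₁-sym I _) (w₁-pivot-zero ¬rows)))

    v-x : ∀ {J} → n ∸ suc k < J → J < n → v J ≈ - (x (μ J) * qt⁻¹)
    v-x a<J J<n = ≈-trans (v-band a<J (ℕₚ.<⇒≤ J<n)) (-‿cong (*-congʳ (x-row (band-start a<J) J<n)))

    v-corner : v n ≈ - (- (s * x k * q ⁻¹) * qt⁻¹)
    v-corner = ≈-trans (v-band pivot<n ≤-refl)
                       (-‿cong (*-congʳ x-corner))

    band∉Rows : ∀ {J} → n ∸ suc k ≤ J → ¬ Rows (suc k) J
    band∉Rows a≤J rows = under rows a≤J

    ≈-outside : ∀ {I J X p} → Outside (suc k) I J → X ≈ p → X ≈ expected (suc k) I J p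
    ≈-outside outside X≈p = ≈-trans X≈p (reflexive (≡.sym (expected-outside outside)))

    on-pivot-col : ∀ {I p} → D I (n ∸ suc k) ≈ p → D I (n ∸ suc k) ≈ expected (suc k) I (n ∸ suc k) p
    on-pivot-col {I} {p} D≈p with I ≟ suc k | I ≟ 2 ℕ.+ k | I ≟ 3 ℕ.+ k
    ... | yes refl | _ | _ = ≈-trans D≈p (≈-sym (reflexive expected-pivot))
    ... | no _ | yes refl | _ = begin
      D (2 ℕ.+ k) (n ∸ suc k)     ≈⟨ D-pivot₁ ⟩
      x 2                         ≡⟨ ≡.cong x (≡.sym pivot-offset) ⟩
      x ((n ∸ suc k ℕ.+ suc k ℕ.+ 2) ∸ n) ≡⟨ ≡.sym (expected-row-x ≤-refl pivot<n) ⟩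
      expected (suc k) (2 ℕ.+ k) (n ∸ suc k) p ∎
    ... | no _ | no _ | yes refl = begin
      D (3 ℕ.+ k) (n ∸ suc k)     ≈⟨ ≈-trans D-pivot₂ (≈-sym y₂≈st) ⟩
      y 2                         ≡⟨ ≡.cong y (≡.sym pivot-offset) ⟩
      y ((n ∸ suc k ℕ.+ suc k ℕ.+ 2) ∸ n) ≡⟨ ≡.sym (expected-row-y ≤-refl pivot<n) ⟩
      expected (suc k) (3 ℕ.+ k) (n ∸ suc k) p ∎
    ... | no I≢K | no I≢K+1 | no I≢K+2 =
      ≈-outside (outside-¬Rows (¬Rows I≢K I≢K+1 I≢K+2) (band∉Rows ≤-refl)) D≈p

    on-pivot-row : ∀ {J p} → D (n ∸ suc k) J ≈ p → D (n ∸ suc k) J ≈ expected (suc k) (n ∸ suc k) J p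
    on-pivot-row {J} {p} D≈p with J ≟ suc k | J ≟ 2 ℕ.+ k | J ≟ 3 ℕ.+ k
    ... | yes refl | _ | _ = ≈-trans D≈p (≈-sym (reflexive expected-pivotᵀ))
    ... | no _ | yes refl | _ = begin
      D (n ∸ suc k) (2 ℕ.+ k)     ≈⟨ D-pivot₁ᵀ ⟩
      x 2                         ≡⟨ ≡.cong x (≡.sym pivot-offset) ⟩
      x ((n ∸ suc k ℕ.+ suc k ℕ.+ 2) ∸ n) ≡⟨ ≡.sym (expected-col-x ≤-refl pivot<n) ⟩
      expected (suc k) (n ∸ suc k) (2 ℕ.+ k) p ∎
    ... | no _ | no _ | yes refl = begin
      D (n ∸ suc k) (3 ℕ.+ k)     ≈⟨ ≈-trans D-pivot₂ᵀ (≈-sym y₂≈st) ⟩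
      y 2                         ≡⟨ ≡.cong y (≡.sym pivot-offset) ⟩
      y ((n ∸ suc k ℕ.+ suc k ℕ.+ 2) ∸ n) ≡⟨ ≡.sym (expected-col-y ≤-refl pivot<n) ⟩
      expected (suc k) (n ∸ suc k) (3 ℕ.+ k) p ∎
    ... | no J≢K | no J≢K+1 | no J≢K+2 =
      ≈-outside (outside-¬Rows (band∉Rows ≤-refl) (¬Rows J≢K J≢K+1 J≢K+2)) D≈p

    inner : ∀ {I J p} → I ≤ n ∸ suc k → J ≤ n ∸ suc k → D I J ≈ p → D I J ≈ expected (suc k) I J p
    inner {I} {J} {p} I≤a J≤a D≈p with J ≟ n ∸ suc k | I ≟ n ∸ suc k
    ... | yes refl | _        = on-pivot-col D≈p
    ... | no _     | yes refl = on-pivot-row D≈p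
    ... | no J≢a   | no I≢a   =
      ≈-outside ((λ _ → ℕₚ.≤∧≢⇒< J≤a J≢a) , (λ _ → ℕₚ.≤∧≢⇒< I≤a I≢a)) D≈p

    module _ {J : ℕ} (a<J : n ∸ suc k < J) (J≤n : J ≤ n) where

      cleared-row : D (suc k) J + D (suc k) (n ∸ suc k) * v J ≈ 0#
      cleared-row = ≈-trans (+-congˡ (*-cong D-pivot (v-band a<J J≤n))) (pivot-cancel _)

      next-x-row : ∀ {p′} →
                   D (2 ℕ.+ k) J + D (2 ℕ.+ k) (n ∸ suc k) * v J ≈ expected (suc k) (2 ℕ.+ k) J p′
      next-x-row {p′} with J ≟ n
      ... | yes refl = begin
        D (2 ℕ.+ k) n + D (2 ℕ.+ k) (n ∸ suc k) * v n
          ≈⟨ +-cong y-corner (*-cong D-pivot₁ v-corner) ⟩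
        - (s * y k * q ⁻¹) + (r * t) * (- (- (s * x k * q ⁻¹) * qt⁻¹))
          ≈⟨ +-congˡ (eliminate r _) ⟩
        - (s * y k * q ⁻¹) + (- (r * q ⁻¹)) * (- (s * x k * q ⁻¹))
          ≈⟨ corner-sum _ _ _ ⟩
        - (s * (y k + (- (r * q ⁻¹)) * x k) * q ⁻¹)
          ≈⟨ -‿cong (*-congʳ (*-congˡ (≈-sym (x-from-y k 1≤k)))) ⟩
        - (s * x (suc k) * q ⁻¹)
          ≡⟨ ≡.sym expected-corner-x ⟩
        expected (suc k) (2 ℕ.+ k) n p′ ∎
      ... | no J≢n = begin
        D (2 ℕ.+ k) J + D (2 ℕ.+ k) (n ∸ suc k) * v J
          ≈⟨ +-cong (y-row (band-start a<J) J<n) (*-cong D-pivot₁ (v-x a<J J<n)) ⟩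
        y (μ J) + (r * t) * (- (x (μ J) * qt⁻¹))
          ≈⟨ +-congˡ (eliminate r _) ⟩
        y (μ J) + (- (r * q ⁻¹)) * x (μ J)
          ≡⟨ ≡.cong (λ i → y i + (- (r * q ⁻¹)) * x i) (offset a<J) ⟩
        y (2 ℕ.+ excess J) + (- (r * q ⁻¹)) * x (2 ℕ.+ excess J)
          ≈⟨ +-comm _ _ ⟩
        x (3 ℕ.+ excess J)
          ≡⟨ ≡.sym (≡.trans (expected-row-x (<⇒≤ a<J) J<n) (≡.cong x (offset⁺ a<J))) ⟩
        expected (suc k) (2 ℕ.+ k) J p′ ∎
        where J<n = ℕₚ.≤∧≢⇒< J≤n J≢n

      next-y-row : ∀ {p′} →
                   D (3 ℕ.+ k) J + D (3 ℕ.+ k) (n ∸ suc k) * v J ≈ expected (suc k) (3 ℕ.+ k) J p′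
      next-y-row {p′} with J ≟ n
      ... | yes refl = begin
        D (3 ℕ.+ k) n + D (3 ℕ.+ k) (n ∸ suc k) * v n
          ≈⟨ +-cong (zero-row (m∸n≤m n k)) (*-cong D-pivot₂ v-corner) ⟩
        0# + (s * t) * (- (- (s * x k * q ⁻¹) * qt⁻¹))
          ≈⟨ ≈-trans (+-identityˡ _) (eliminate s _) ⟩
        (- (s * q ⁻¹)) * (- (s * x k * q ⁻¹))
          ≈⟨ scale-corner _ _ ⟩
        - (s * ((- (s * q ⁻¹)) * x k) * q ⁻¹)
          ≡⟨ ≡.cong (λ z → - (s * z * q ⁻¹)) (≡.sym (y-from-x k 1≤k)) ⟩
        - (s * y (suc k) * q ⁻¹)
          ≡⟨ ≡.sym expected-corner-y ⟩
        expected (suc k) (3 ℕ.+ k) n p′ ∎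
      ... | no J≢n = begin
        D (3 ℕ.+ k) J + D (3 ℕ.+ k) (n ∸ suc k) * v J
          ≈⟨ +-cong (zero-row (band-start a<J)) (*-cong D-pivot₂ (v-x a<J J<n)) ⟩
        0# + (s * t) * (- (x (μ J) * qt⁻¹))
          ≈⟨ ≈-trans (+-identityˡ _) (eliminate s _) ⟩
        (- (s * q ⁻¹)) * x (μ J)
          ≡⟨ ≡.cong (λ i → (- (s * q ⁻¹)) * x i) (offset a<J) ⟩
        y (3 ℕ.+ excess J)
          ≡⟨ ≡.sym (≡.trans (expected-row-y (<⇒≤ a<J) J<n) (≡.cong y (offset⁺ a<J))) ⟩
        expected (suc k) (3 ℕ.+ k) J p′ ∎
        where J<n = ℕₚ.≤∧≢⇒< J≤n J≢n

      x-transpose : D J (suc k) ≈ D (suc k) J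
      x-transpose with J ≟ n
      ... | yes refl = ≈-trans x-cornerᵀ (≈-sym x-corner)
      ... | no J≢n   = ≈-trans (x-col (band-start a<J) J<n) (≈-sym (x-row (band-start a<J) J<n))
        where J<n = ℕₚ.≤∧≢⇒< J≤n J≢n

      cleared-col : D J (suc k) + v J * D (n ∸ suc k) (suc k) ≈ 0#
      cleared-col = ≈-trans (+-cong x-transpose (*-cong (v-band a<J J≤n) D-pivotᵀ)) (pivot-cancelᵀ _)

      next-x-col : ∀ {p′} →
                   D J (2 ℕ.+ k) + v J * D (n ∸ suc k) (2 ℕ.+ k) ≈ expected (suc k) J (2 ℕ.+ k) p′
      next-x-col {p′} with J ≟ n
      ... | yes refl = begin
        D n (2 ℕ.+ k) + v n * D (n ∸ suc k) (2 ℕ.+ k)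
          ≈⟨ +-cong y-cornerᵀ (*-cong v-corner D-pivot₁ᵀ) ⟩
        - (s * y k * q ⁻¹) + (- (- (s * x k * q ⁻¹) * qt⁻¹)) * (r * t)
          ≈⟨ +-congˡ (eliminateᵀ r _) ⟩
        - (s * y k * q ⁻¹) + (- (r * q ⁻¹)) * (- (s * x k * q ⁻¹))
          ≈⟨ corner-sum _ _ _ ⟩
        - (s * (y k + (- (r * q ⁻¹)) * x k) * q ⁻¹)
          ≈⟨ -‿cong (*-congʳ (*-congˡ (≈-sym (x-from-y k 1≤k)))) ⟩
        - (s * x (suc k) * q ⁻¹)
          ≡⟨ ≡.sym expected-corner-xᵀ ⟩
        expected (suc k) n (2 ℕ.+ k) p′ ∎
      ... | no J≢n = begin
        D J (2 ℕ.+ k) + v J * D (n ∸ suc k) (2 ℕ.+ k)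
          ≈⟨ +-cong (y-col (band-start a<J) J<n) (*-cong (v-x a<J J<n) D-pivot₁ᵀ) ⟩
        y (μ J) + (- (x (μ J) * qt⁻¹)) * (r * t)
          ≈⟨ +-congˡ (eliminateᵀ r _) ⟩
        y (μ J) + (- (r * q ⁻¹)) * x (μ J)
          ≡⟨ ≡.cong (λ i → y i + (- (r * q ⁻¹)) * x i) (offset a<J) ⟩
        y (2 ℕ.+ excess J) + (- (r * q ⁻¹)) * x (2 ℕ.+ excess J)
          ≈⟨ +-comm _ _ ⟩
        x (3 ℕ.+ excess J)
          ≡⟨ ≡.sym (≡.trans (expected-col-x (<⇒≤ a<J) J<n) (≡.cong x (offset⁺ a<J))) ⟩
        expected (suc k) J (2 ℕ.+ k) p′ ∎
        where J<n = ℕₚ.≤∧≢⇒< J≤n J≢n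

      next-y-col : ∀ {p′} →
                   D J (3 ℕ.+ k) + v J * D (n ∸ suc k) (3 ℕ.+ k) ≈ expected (suc k) J (3 ℕ.+ k) p′
      next-y-col {p′} with J ≟ n
      ... | yes refl = begin
        D n (3 ℕ.+ k) + v n * D (n ∸ suc k) (3 ℕ.+ k)
          ≈⟨ +-cong (zero-col (m∸n≤m n k)) (*-cong v-corner D-pivot₂ᵀ) ⟩
        0# + (- (- (s * x k * q ⁻¹) * qt⁻¹)) * (s * t)
          ≈⟨ ≈-trans (+-identityˡ _) (eliminateᵀ s _) ⟩
        (- (s * q ⁻¹)) * (- (s * x k * q ⁻¹))
          ≈⟨ scale-corner _ _ ⟩
        - (s * ((- (s * q ⁻¹)) * x k) * q ⁻¹)
          ≡⟨ ≡.cong (λ z → - (s * z * q ⁻¹)) (≡.sym (y-from-x k 1≤k)) ⟩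
        - (s * y (suc k) * q ⁻¹)
          ≡⟨ ≡.sym expected-corner-yᵀ ⟩
        expected (suc k) n (3 ℕ.+ k) p′ ∎
      ... | no J≢n = begin
        D J (3 ℕ.+ k) + v J * D (n ∸ suc k) (3 ℕ.+ k)
          ≈⟨ +-cong (zero-col (band-start a<J)) (*-cong (v-x a<J J<n) D-pivot₂ᵀ) ⟩
        0# + (- (x (μ J) * qt⁻¹)) * (s * t)
          ≈⟨ ≈-trans (+-identityˡ _) (eliminateᵀ s _) ⟩
        (- (s * q ⁻¹)) * x (μ J)
          ≡⟨ ≡.cong (λ i → (- (s * q ⁻¹)) * x i) (offset a<J) ⟩
        y (3 ℕ.+ excess J)
          ≡⟨ ≡.sym (≡.trans (expected-col-y (<⇒≤ a<J) J<n) (≡.cong y (offset⁺ a<J))) ⟩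
        expected (suc k) J (3 ℕ.+ k) p′ ∎
        where J<n = ℕₚ.≤∧≢⇒< J≤n J≢n

    mixed : ∀ {I J p} → I ≤ n ∸ suc k → n ∸ suc k < J → J ≤ n → D I J ≈ p →
            D I J + D I (n ∸ suc k) * v J ≈ expected (suc k) I J p
    mixed {I} {J} {p} I≤a a<J J≤n D≈p with I ≟ suc k | I ≟ 2 ℕ.+ k | I ≟ 3 ℕ.+ k
    ... | yes refl | _ | _ = ≈-trans (cleared-row a<J J≤n) (reflexive (≡.sym (expected-row-zero a<J J≤n)))
    ... | no _ | yes refl | _ = next-x-row a<J J≤n
    ... | no _ | no _ | yes refl = next-y-row a<J J≤n
    ... | no I≢K | no I≢K+1 | no I≢K+2 =
      ≈-trans (+-killˡ (D-pivot-col-zero ¬rows))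
              (≈-outside (outside-¬Rows ¬rows (band∉Rows (<⇒≤ a<J))) D≈p)
      where ¬rows = ¬Rows I≢K I≢K+1 I≢K+2

    mixedᵀ : ∀ {I J p} → n ∸ suc k < I → I ≤ n → J ≤ n ∸ suc k → D I J ≈ p →
             D I J + v I * D (n ∸ suc k) J ≈ expected (suc k) I J p
    mixedᵀ {I} {J} {p} a<I I≤n J≤a D≈p with J ≟ suc k | J ≟ 2 ℕ.+ k | J ≟ 3 ℕ.+ k
    ... | yes refl | _ | _ = ≈-trans (cleared-col a<I I≤n) (reflexive (≡.sym (expected-col-zero a<I I≤n)))
    ... | no _ | yes refl | _ = next-x-col a<I I≤n
    ... | no _ | no _ | yes refl = next-y-col a<I I≤n
    ... | no J≢K | no J≢K+1 | no J≢K+2 =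
      ≈-trans (+-killʳ (D-pivot-row-zero ¬rows))
              (≈-outside (outside-¬Rows (band∉Rows (<⇒≤ a<I)) ¬rows) D≈p)
      where ¬rows = ¬Rows J≢K J≢K+1 J≢K+2

    outer : ∀ {I J p} → n ∸ suc k < I → n ∸ suc k < J → D I J ≈ p →
            D I J + v I * D (n ∸ suc k) J + D I (n ∸ suc k) * v J ≈ expected (suc k) I J p
    outer {I} {J} {p} a<I a<J D≈p =
      ≈-trans (+-killˡ (D-pivot-col-zero ¬rows-I))
        (≈-trans (+-killʳ (D-pivot-row-zero ¬rows-J)) (≈-outside (outside-¬Rows ¬rows-I ¬rows-J) D≈p))
      where
      ¬rows-I = band∉Rows (<⇒≤ a<I)
      ¬rows-J = band∉Rows (<⇒≤ a<J)

    step-entry : ∀ {I J p} → I ≤ n → J ≤ n → D I J ≈ p →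
                 D I J + v I * D (n ∸ suc k) J + D I (n ∸ suc k) * v J ≈ expected (suc k) I J p
    step-entry {I} {J} {p} I≤n J≤n D≈p with I ℕ.≤? n ∸ suc k | J ℕ.≤? n ∸ suc k
    ... | yes I≤a | yes J≤a =
      ≈-trans (≈-trans (+-killʳ (v-off J≤a)) (+-killˡ (v-off I≤a))) (inner I≤a J≤a D≈p)
    ... | yes I≤a | no J≰a  =
      ≈-trans (+-congʳ (+-killˡ (v-off I≤a))) (mixed I≤a (ℕₚ.≰⇒> J≰a) J≤n D≈p)
    ... | no I≰a  | yes J≤a =
      ≈-trans (+-killʳ (v-off J≤a)) (mixedᵀ (ℕₚ.≰⇒> I≰a) I≤n J≤a D≈p)
    ... | no I≰a  | no J≰a  = outer (ℕₚ.≰⇒> I≰a) (ℕₚ.≰⇒> J≰a) D≈p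

  open Matrices F using ([_]; combination; IsRowUpdate; foldr-R-row-update; congruence-row-update)

  range-above : ∀ {a b} len → a < b → All (_≢ a) (range b len)
  range-above zero      _   = []
  range-above (suc len) a<b = ℕₚ.>⇒≢ a<b ∷ range-above len (ℕₚ.m<n⇒m<1+n a<b)

  combination-below : ∀ c {b J} len → J < b → combination c (range b len) J ≈ 0#
  combination-below c zero      J<b = ≈-refl
  combination-below c {b} {J} (suc len) J<b = begin
    c b * [ J ≡ᵇ b ] + combination c (range (suc b) len) J
      ≈⟨ +-cong (*-congˡ (reflexive (skip (λ t → ℕₚ.<⇒≢ J<b (≡ᵇ⇒≡ J b t)) refl)))
                (combination-below c len (ℕₚ.m<n⇒m<1+n J<b)) ⟩
    c b * 0# + 0#
      ≈⟨ ≈-trans (+-identityʳ _) (zeroʳ _) ⟩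
    0# ∎

  combination-in : ∀ c {b J} len → b ≤ J → J < b ℕ.+ len → combination c (range b len) J ≈ c J
  combination-in c zero b≤J J<b+0 =
    ⊥-elim (ℕₚ.<⇒≱ (ℕₚ.<-≤-trans J<b+0 (ℕₚ.≤-reflexive (ℕₚ.+-identityʳ _))) b≤J)
  combination-in c {b} {J} (suc len) b≤J J<b+1+len with J ≟ b
  ... | yes refl = begin
    c J * [ J ≡ᵇ J ] + combination c (range (suc J) len) J
      ≈⟨ +-cong (*-congˡ (reflexive (take (≡⇒≡ᵇ J J refl)))) (combination-below c len (ℕₚ.n<1+n J)) ⟩
    c J * 1# + 0#  ≈⟨ ≈-trans (+-identityʳ _) (*-identityʳ _) ⟩
    c J            ∎
  ... | no J≢b = begin
    c b * [ J ≡ᵇ b ] + combination c (range (suc b) len) J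
      ≈⟨ +-cong (*-congˡ (reflexive (skip (λ t → J≢b (≡ᵇ⇒≡ J b t)) refl)))
                (combination-in c len (ℕₚ.≤∧≢⇒< b≤J (λ b≡J → J≢b (≡.sym b≡J)))
                                      (ℕₚ.<-≤-trans J<b+1+len (ℕₚ.≤-reflexive (ℕₚ.+-suc b len)))) ⟩
    c b * 0# + c J
      ≈⟨ ≈-trans (+-congʳ (zeroʳ _)) (+-identityˡ _) ⟩
    c J ∎

  fin : ∀ {I} → 1 ≤ I → I ≤ n → Fin n
  fin {suc I} _ I<n = fromℕ< I<n

  idx-fin : ∀ {I} (1≤I : 1 ≤ I) (I≤n : I ≤ n) → idx (fin 1≤I I≤n) ≡ I
  idx-fin {suc I} _ I<n = ≡.cong suc (toℕ-fromℕ< I<n)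

  entry-idx : ∀ (A : Matrix n) i j → entry A (idx i) (idx j) ≡ A i j
  entry-idx A i j with toℕ i ℕ.<? n | toℕ j ℕ.<? n
  ... | yes i<n | yes j<n = ≡.cong₂ A (fromℕ<-toℕ i i<n) (fromℕ<-toℕ j j<n)
  ... | no i≮n  | _       = ⊥-elim (i≮n (toℕ<n i))
  ... | yes _   | no j≮n  = ⊥-elim (j≮n (toℕ<n j))

  entry-≈ : ∀ {A : Matrix n} {D : ℕ → ℕ → Carrier} → (∀ i j → A i j ≈ D (idx i) (idx j)) →
            ∀ {I J} → 1 ≤ I → I ≤ n → 1 ≤ J → J ≤ n → entry A I J ≈ D I J
  entry-≈ {A} {D} A≈D {I} {J} 1≤I I≤n 1≤J J≤n = begin
    entry A I J                ≡⟨ ≡.cong₂ (entry A) (≡.sym idx-fI) (≡.sym idx-fJ) ⟩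
    entry A (idx fI) (idx fJ)  ≡⟨ entry-idx A fI fJ ⟩
    A fI fJ                    ≈⟨ A≈D fI fJ ⟩
    D (idx fI) (idx fJ)        ≡⟨ ≡.cong₂ D idx-fI idx-fJ ⟩
    D I J                      ∎
    where
    fI = fin 1≤I I≤n
    fJ = fin 1≤J J≤n
    idx-fI = idx-fin 1≤I I≤n
    idx-fJ = idx-fin 1≤J J≤n

  W≈expected : ∀ k → Separated n (suc (suc k)) → (∀ i j → W (suc k) i j ≈ w (suc k) (idx i) (idx j)) →
               ∀ i j {p} → p ≈ w (suc k) (idx i) (idx j) →
               W (suc (suc k)) i j ≈ expected (suc (suc k)) (idx i) (idx j) p
  W≈expected k sep IH i j {p} p≈D = begin
    ((transpose S′ ⊗ P) ⊗ S′) i j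
      ≈⟨ congruence-row-update {v = v} S′-update P i j ⟩
    P i j + v I * P f j + (P i f + v I * P f f) * v J
      ≈⟨ +-cong (+-cong (IH i j) (*-congˡ (P≈D-row j)))
                (*-congʳ (+-cong (P≈D-col i) (*-congˡ P≈D-pivot))) ⟩
    D I J + v I * D a J + (D I a + v I * D a a) * v J
      ≈⟨ +-congˡ (*-congʳ (+-killʳ D-aa≈0)) ⟩
    D I J + v I * D a J + D I a * v J
      ≈⟨ Step.step-entry (s≤s z≤n) sep D-shape v-band v-off (toℕ<n i) (toℕ<n j) (≈-sym p≈D) ⟩
    expected K I J p ∎
    where
    I = idx i
    J = idx j
    K = suc (suc k)
    a = n ∸ K
    P = W (suc k)
    D = w (suc k)
    open AtLevel K sep using (rows<band; under; pivot+k≡n; 2+k≤n; w₁-pivot-zero)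
    1≤a = ≤-trans (s≤s z≤n) rows<band
    f = fin 1≤a (m∸n≤m n K)
    idx-f = idx-fin 1≤a (m∸n≤m n K)
    P≈D-row : ∀ j → P f j ≈ D a (idx j)
    P≈D-row j = ≈-trans (IH f j) (reflexive (≡.cong (λ m → D m (idx j)) idx-f))
    P≈D-col : ∀ i → P i f ≈ D (idx i) a
    P≈D-col i = ≈-trans (IH i f) (reflexive (≡.cong (D (idx i)) idx-f))
    P≈D-pivot : P f f ≈ D a a
    P≈D-pivot = ≈-trans (P≈D-row f) (reflexive (≡.cong (D a) idx-f))
    multiplier : ℕ → Carrier
    multiplier m = - (entry P K m * qt⁻¹)
    v : ℕ → Carrier
    v = combination multiplier (range (suc a) K)
    S′ = S K P
    S′-update : IsRowUpdate S′ f v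
    S′-update = foldr-R-row-update f idx-f multiplier (range-above K (ℕₚ.n<1+n a))
    v-band : ∀ {J} → a < J → J ≤ n → v J ≈ - (D K J * qt⁻¹)
    v-band {J} a<J J≤n =
      ≈-trans (combination-in multiplier K a<J (s≤s (ℕₚ.≤-trans J≤n (ℕₚ.≤-reflexive (≡.sym pivot+k≡n)))))
              (-‿cong (*-congʳ (entry-≈ {D = D} IH (s≤s z≤n) K≤n (ℕₚ.≤-trans (s≤s z≤n) a<J) J≤n)))
      where K≤n = ℕₚ.≤-trans (ℕₚ.n≤1+n K) (ℕₚ.≤-trans (ℕₚ.n≤1+n _) 2+k≤n)
    v-off : ∀ {J} → J ≤ a → v J ≈ 0#
    v-off J≤a = combination-below multiplier K (s≤s J≤a)
    D-shape = shape (suc k) (s≤s z≤n) sep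
    D-aa≈0 : D a a ≈ 0#
    D-aa≈0 = ≈-trans (Shape.pivot-row D-shape a) (reflexive (w₁-pivot-zero (λ rows → under rows ≤-refl)))

  W≈w : ∀ k → 1 ≤ k → Separated n k → ∀ i j → W k i j ≈ w k (idx i) (idx j)
  W≈w (suc zero)    _ _   = λ _ _ → ≈-refl
  W≈w (suc (suc k)) _ sep i j =
    W≈expected k sep (W≈w (suc k) (s≤s z≤n) (Separated-pred (suc k) sep)) i j ≈-refl

lemma4 : ∀ {c ℓ} (F : Field c ℓ) → let open Field F in let open Construction F in
    ∀ (n : ℕ) → 7 ≤ n → ∀ (q r s t : Carrier) → ¬ (q ≈ 0#) → ¬ (t ≈ 0#) →
    let open Params n q r s t in
    ∀ (k : ℕ) → 2 ≤ k → k ≤ n₁ n → ∀ (i j : Fin n) →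
    W k i j ≈ expected k (idx i) (idx j) (W (pred k) i j)
lemma4 F n _ q r s t q≉0 t≉0 (suc (suc k)) (s≤s (s≤s z≤n)) k≤n₁ i j = W≈expected k sep IH i j (IH i j)
  where
  open Elimination F n q r s t q≉0 t≉0
  sep = n₁-separated n (s≤s z≤n) k≤n₁
  IH = W≈w (suc k) (s≤s z≤n) (Separated-pred (suc k) sep)
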